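{- Let $D$ be a cellularly embedded diagram of a spatial graph $G$ on a closed surface $\Sigma$, with connected projection. Suppose that there is a diagram $D'$ of an Eulerian graph $G'$ obtained from $D$ by adding $o(G)/2$ edges without introducing new crossing points or vertices, such that the over/under crossing decorations of $D'$ come from a checkerboard coloring of $D'$. Then $\beta_1(S_A(D))+\beta_1(S_B(D))\ge c(D)-\chi(G)-\frac{o(G)}{2}+\chi(\Sigma)$.
   Context: $G$ is a finite graph, $\chi(G)$ its Euler characteristic, $o(G)$ the number of vertices of odd degree, $\beta_1$ the first Betti number; an Eulerian graph is one with all vertex degrees even. A diagram $D$ on a closed surface $\Sigma$ is a generic immersion of $G$ in $\Sigma$ with double points being crossings with over/under information; $c(D)$ is the number of crossings; $D$ is cellularly embedded if all regions of the complement of its projection are open disks. $S_A(D)$ (resp. $S_B(D)$) is the graph obtained by replacing every crossing by its Kauffman A-smoothing (resp. B-smoothing). A checkerboard coloring of $D'$ is a coloring of the regions of $\Sigma$ minus the projection of $D'$ by black and white such that regions adjacent along an edge have different colors; the crossing decorations come from the checkerboard coloring if at every crossing the A-smoothing joins the two white regions incident to the crossing (and the B-smoothing joins the two black ones). -}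

module Defs where

-- Combinatorial model of cellularly embedded diagrams on closed surfaces,
-- via generalized maps (gmaps), which encode cellular embeddings of
-- connected graphs in closed (orientable or not) surfaces.

open import Data.Nat using (ℕ; zero; suc; _+_; _*_; _<ᵇ_; _/_)
open import Data.Integer as ℤ using (ℤ; +_; _-_)
open import Data.Bool using (Bool; true; false; _∧_; _∨_; not; if_then_else_)
open import Data.Fin using (Fin; zero; suc; toℕ; _↑ˡ_; _↑ʳ_)
open import Data.Fin.Properties using (_≟_)
open import Data.List using (List; []; _∷_)
open import Data.Product using (Σ; _×_; _,_)
open import Relation.Nullary.Decidable using (⌊_⌋)
open import Relation.Binary.PropositionalEquality using (_≡_; _≢_)

anyFin : ∀ {n} → (Fin n → Bool) → Bool
anyFin {zero}  p = false
anyFin {suc n} p = p zero ∨ anyFin (λ i → p (suc i))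

countFin : ∀ {n} → (Fin n → Bool) → ℕ
countFin {zero}  p = 0
countFin {suc n} p = (if p zero then 1 else 0) + countFin (λ i → p (suc i))

anyL : ∀ {A : Set} → (A → Bool) → List A → Bool
anyL p []       = false
anyL p (x ∷ xs) = p x ∨ anyL p xs

reachIn : ∀ {n} → List (Fin n → Fin n) → ℕ → Fin n → Fin n → Bool
reachIn gs zero    i j = ⌊ i ≟ j ⌋
reachIn gs (suc k) i j = ⌊ i ≟ j ⌋ ∨ anyL (λ g → reachIn gs k (g i) j) gs

-- same orbit under the group generated by gs (all gs below are involutions,
-- so the orbit relation is reachability; n steps suffice)
sameOrbit : ∀ {n} → List (Fin n → Fin n) → Fin n → Fin n → Bool
sameOrbit {n} gs = reachIn gs n

isRep : ∀ {n} → List (Fin n → Fin n) → Fin n → Bool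
isRep gs i = not (anyFin (λ j → (toℕ j <ᵇ toℕ i) ∧ sameOrbit gs j i))

numOrbits : ∀ {n} → List (Fin n → Fin n) → (Fin n → Bool) → ℕ
numOrbits gs P = countFin (λ i → isRep gs i ∧ P i)

orbitSize : ∀ {n} → List (Fin n → Fin n) → Fin n → ℕ
orbitSize gs i = countFin (sameOrbit gs i)

-- Generalized maps: flags Fin n; θ₀ changes the vertex, θ₁ the edge,
-- θ₂ the face of a flag.  A gmap is a cellular embedding of a graph in a
-- closed surface (the surface is connected iff the gmap is connected).

record GMap (n : ℕ) : Set where
  field
    θ₀ θ₁ θ₂ : Fin n → Fin n
    inv₀ : ∀ f → θ₀ (θ₀ f) ≡ f
    inv₁ : ∀ f → θ₁ (θ₁ f) ≡ f
    inv₂ : ∀ f → θ₂ (θ₂ f) ≡ f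
    fpf₀ : ∀ f → θ₀ f ≢ f
    fpf₁ : ∀ f → θ₁ f ≢ f
    fpf₂ : ∀ f → θ₂ f ≢ f
    comm₀₂ : ∀ f → θ₀ (θ₂ f) ≡ θ₂ (θ₀ f)
    fpf₀₂ : ∀ f → θ₀ (θ₂ f) ≢ f

  vGens eGens fGens allGens : List (Fin n → Fin n)
  vGens = θ₁ ∷ θ₂ ∷ []
  eGens = θ₀ ∷ θ₂ ∷ []
  fGens = θ₀ ∷ θ₁ ∷ []
  allGens = θ₀ ∷ θ₁ ∷ θ₂ ∷ []

  degree : Fin n → ℕ
  degree f = orbitSize vGens f / 2

  #V #E #F : ℕ
  #V = numOrbits vGens (λ _ → true)
  #E = numOrbits eGens (λ _ → true)
  #F = numOrbits fGens (λ _ → true)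

  χΣ : ℤ
  χΣ = (+ #V - + #E) ℤ.+ + #F

  Connected : Set
  Connected = ∀ i j → sameOrbit allGens i j ≡ true

-- The projection is the gmap; vertices are either crossings
-- (4-valent double points) or vertices of G.  Crossing information is
-- recorded, at each crossing, by which pair of opposite corners are the
-- A-regions (the regions swept by the over-strand under the Kauffman
-- A-convention); the other two corners are the B-regions.
-- A corner (vertex, face incidence) is a pair {f, θ₁ f}; θ₂ (θ₁ f) lies in
-- the next corner around the vertex.

record Diagram (n : ℕ) : Set where
  field
    map : GMap n
  open GMap map public
  field
    cross : Fin n → Bool
    isA   : Fin n → Bool
    cross-θ₁ : ∀ f → cross (θ₁ f) ≡ cross f
    cross-θ₂ : ∀ f → cross (θ₂ f) ≡ cross f
    cross-deg4 : ∀ f → cross f ≡ true → degree f ≡ 4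
    A-corner : ∀ f → cross f ≡ true → isA (θ₁ f) ≡ isA f
    A-alt    : ∀ f → cross f ≡ true → isA (θ₂ (θ₁ f)) ≡ not (isA f)

  -- passing straight through a crossing to the opposite edge-end
  pass : Fin n → Fin n
  pass f = if cross f then θ₁ (θ₂ (θ₁ f)) else f

  strandGens : List (Fin n → Fin n)
  strandGens = θ₀ ∷ θ₂ ∷ pass ∷ []

  field
    -- G is a graph: every strand of the projection runs into a vertex of G
    -- (no closed vertex-free components)
    strand-vertex : ∀ f → anyFin (λ g → sameOrbit strandGens f g ∧ not (cross g)) ≡ true

  c : ℕ
  c = numOrbits vGens cross

  #VG : ℕ
  #VG = numOrbits vGens (λ f → not (cross f))

  #EG : ℕ
  #EG = numOrbits strandGens (λ _ → true)

  χG : ℤ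
  χG = + #VG - + #EG

  odd : ℕ → Bool
  odd zero = false
  odd (suc k) = not (odd k)

  oG : ℕ
  oG = numOrbits vGens (λ f → not (cross f) ∧ odd (degree f))

  Eulerian : Set
  Eulerian = ∀ f → cross f ≡ false → odd (degree f) ≡ false

  -- S_A(D) is homotopy equivalent to the graph H_A with
  -- vertices: the vertices of G, one midpoint per edge of the projection,
  -- one vertex per smoothing arc (two per crossing); edges: the edge-ends
  -- (2 per projection edge), each joining its edge-midpoint to its
  -- G-vertex or to its smoothing arc.  The A-smoothing arcs run around the
  -- B-corners, the B-smoothing arcs around the A-corners.
  stepA stepB : Fin n → Fin n
  stepA f = if cross f ∧ isA f then f else θ₁ f
  stepB f = if cross f ∧ not (isA f) then f else θ₁ f

  compA compB : ℕ
  compA = numOrbits (θ₀ ∷ θ₂ ∷ stepA ∷ []) (λ _ → true)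
  compB = numOrbits (θ₀ ∷ θ₂ ∷ stepB ∷ []) (λ _ → true)

  -- β₁ = #edges − #vertices + #components
  β₁SA β₁SB : ℤ
  β₁SA = (+ (2 * #E) - + (#VG + #E + 2 * c)) ℤ.+ + compA
  β₁SB = (+ (2 * #E) - + (#VG + #E + 2 * c)) ℤ.+ + compB

-- The flags of D are the first n flags of D' (via ↑ˡ); the new
-- flags (n ↑ʳ j) form the added edges.  Deleting the new edges from D'
-- gives back D; the added edges are drawn inside faces (each splits a face,
-- so the surface is unchanged).

module _ {n m : ℕ} (D : Diagram n) (D' : Diagram (n + m)) where
  private
    module D  = Diagram D
    module D' = Diagram D'

  isOld : Fin (n + m) → Bool
  isOld g = toℕ g <ᵇ n

  -- θ₁ of D' with the new edges deleted
  skipNew : ℕ → Fin (n + m) → Fin (n + m)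
  skipNew zero g = g
  skipNew (suc k) g = if isOld g then g else skipNew k (D'.θ₁ (D'.θ₂ g))

  record AddsEdges (k : ℕ) : Set where
    field
      θ₀-old : ∀ f → D'.θ₀ (f ↑ˡ m) ≡ (D.θ₀ f) ↑ˡ m
      θ₂-old : ∀ f → D'.θ₂ (f ↑ˡ m) ≡ (D.θ₂ f) ↑ˡ m
      θ₀-new : ∀ j → isOld (D'.θ₀ (n ↑ʳ j)) ≡ false
      θ₂-new : ∀ j → isOld (D'.θ₂ (n ↑ʳ j)) ≡ false
      θ₁-del : ∀ f → skipNew (n + m) (D'.θ₁ (f ↑ˡ m)) ≡ (D.θ₁ f) ↑ˡ m
      cross-old : ∀ f → D'.cross (f ↑ˡ m) ≡ D.cross f
      isA-old   : ∀ f → D'.isA (f ↑ˡ m) ≡ D.isA f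
      cross-new : ∀ j → D'.cross (n ↑ʳ j) ≡ false
      new-at-old : ∀ j → anyFin (λ f → sameOrbit D'.vGens (n ↑ʳ j) (f ↑ˡ m)) ≡ true
      vertices   : D'.#V ≡ D.#V
      edges : D'.#E ≡ D.#E + k
      faces : D'.#F ≡ D.#F + k

-- A checkerboard colouring of D' (true = white) such that the crossing
-- decorations come from it: at each crossing the A-corners are white.
CheckerboardDecorated : ∀ {n} → Diagram n → Set
CheckerboardDecorated {n} D = Σ (Fin n → Bool) λ col →
    (∀ f → col (θ₀ f) ≡ col f)
  × (∀ f → col (θ₁ f) ≡ col f)
  × (∀ f → col (θ₂ f) ≡ not (col f))
  × (∀ f → cross f ≡ true → isA f ≡ col f)
  where open Diagram D

{-# OPTIONS --safe #-}
module Submission where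

-- Colour the faces of D' black and white.  Cutting every white corner of D' leaves at least one region per
-- black face.  The smoothing of D' that keeps the black crossing corners arises from these regions by
-- re-joining the black corners at each vertex of G, which merges at most
-- (#black corners at vertices of G − #V(G)) regions; since half of the 2 #E(D') corners are black and 2c of
-- those lie at crossings, the smoothing has at least #black faces + #V(G) + 2c − #E(D') components.  The added
-- edges end at vertices of G, where every corner is kept, so deleting them merges nothing: the bound holds for
-- S_A(D), and with the colours exchanged for S_B(D).  Adding the two bounds, using #faces(D') = #F(D) + k,
-- #E(D') = #E(D) + k, #E(D) ≥ #E(G) + 2c and β₁ = #edges − #vertices + #components, gives the inequality.

open import Defs

module SmoothingBounds where

  open import Level using (0ℓ)
  open import Data.Nat using (ℕ; zero; suc; _+_; _*_; _≤_; _<_; z≤n; s≤s; _<ᵇ_; _%_)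
  import Data.Nat.Properties as ℕP
  open import Data.Nat.DivMod using (m≡m%n+[m/n]*n; m%n<n)
  open import Data.Nat.Tactic.RingSolver using (solve-∀)
  open import Data.Integer as ℤ using (ℤ; _-_)
  import Data.Integer.Properties as ℤP
  import Data.Integer.Tactic.RingSolver as ℤSolver
  open import Data.Bool using (Bool; true; false; _∧_; _∨_; not; if_then_else_; T)
  open import Data.Bool.Properties
    using (∧-conicalˡ; ∧-conicalʳ; ∧-identityʳ; ∧-zeroʳ; ∧-assoc; ∧-comm;
           not-involutive; not-injective; not-¬; ¬-not)
    renaming (_≟_ to _≟ᵇ_)
  open import Data.Unit using (tt)
  open import Data.Fin using (Fin; zero; suc; toℕ; _↑ˡ_; _↑ʳ_; splitAt)
  open import Data.Fin.Properties using (_≟_; suc-injective; toℕ-injective; toℕ<n; toℕ-↑ˡ; join-splitAt)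
  open import Data.List using (List; []; _∷_; length; applyUpTo)
  open import Data.List.Properties using (length-applyUpTo)
  open import Data.List.Membership.Propositional.Properties using (∈-applyUpTo⁺; ∈-applyUpTo⁻)
  open import Data.List.Relation.Unary.AllPairs using ([]; _∷_)
  open import Data.List.Relation.Unary.Unique.Propositional using (Unique)
  open import Data.List.Relation.Unary.All as All using (All; []; _∷_)
  open import Data.List.Relation.Unary.Any using (here; there)
  open import Data.List.Membership.Propositional using (_∈_)
  open import Data.Product using (Σ; _×_; _,_; proj₁; proj₂)
  open import Data.Sum using (_⊎_; inj₁; inj₂)
  open import Data.Empty using (⊥; ⊥-elim)
  open import Relation.Nullary using (yes; no)
  open import Relation.Nullary.Decidable using (⌊_⌋)
  open import Relation.Binary using (Rel; IsEquivalence; tri<; tri≈; tri>)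
  open import Relation.Binary.PropositionalEquality
  open import Function using (_∘_)

  ∨-trueˡ : ∀ {a} b → a ≡ true → a ∨ b ≡ true
  ∨-trueˡ b refl = refl

  ∨-trueʳ : ∀ a {b} → b ≡ true → a ∨ b ≡ true
  ∨-trueʳ true  _    = refl
  ∨-trueʳ false refl = refl

  ∨-true⁻ : ∀ a {b} → a ∨ b ≡ true → a ≡ true ⊎ b ≡ true
  ∨-true⁻ true  _ = inj₁ refl
  ∨-true⁻ false h = inj₂ h

  ∧-true : ∀ {a b} → a ≡ true → b ≡ true → a ∧ b ≡ true
  ∧-true refl refl = refl

  ∧-trueˡ : ∀ a {b} → a ∧ b ≡ true → a ≡ true
  ∧-trueˡ a {b} = ∧-conicalˡ a b

  ∧-trueʳ : ∀ a {b} → a ∧ b ≡ true → b ≡ true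
  ∧-trueʳ a {b} = ∧-conicalʳ a b

  not-true : ∀ {a} → not a ≡ true → a ≡ false
  not-true {false} _ = refl

  Bool-ext : ∀ {a b : Bool} → (a ≡ true → b ≡ true) → (b ≡ true → a ≡ true) → a ≡ b
  Bool-ext {true}  f g         = sym (f refl)
  Bool-ext {false} {true}  f g = g refl
  Bool-ext {false} {false} f g = refl

  <ᵇ⇒< : ∀ {m n} → (m <ᵇ n) ≡ true → m < n
  <ᵇ⇒< {m} {n} h = ℕP.<ᵇ⇒< m n (subst T (sym h) tt)

  <⇒<ᵇ : ∀ {m n} → m < n → (m <ᵇ n) ≡ true
  <⇒<ᵇ {m} {n} lt with m <ᵇ n | ℕP.<⇒<ᵇ lt
  ... | true | _ = refl

  ≟-sound : ∀ {n} {i j : Fin n} → ⌊ i ≟ j ⌋ ≡ true → i ≡ j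
  ≟-sound {i = i} {j} h with i ≟ j
  ... | yes e = e

  ≟-refl : ∀ {n} (i : Fin n) → ⌊ i ≟ i ⌋ ≡ true
  ≟-refl i with i ≟ i
  ... | yes _ = refl
  ... | no i≢i = ⊥-elim (i≢i refl)

  ≟-≢ : ∀ {n} {i j : Fin n} → i ≢ j → ⌊ i ≟ j ⌋ ≡ false
  ≟-≢ {i = i} {j} i≢j with i ≟ j
  ... | yes e = ⊥-elim (i≢j e)
  ... | no _  = refl

  ≟-suc : ∀ {n} (i j : Fin n) → ⌊ suc i ≟ suc j ⌋ ≡ ⌊ i ≟ j ⌋
  ≟-suc i j with i ≟ j
  ... | yes refl = refl
  ... | no _     = refl

  anyFin⁺ : ∀ {n} (p : Fin n → Bool) i → p i ≡ true → anyFin p ≡ true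
  anyFin⁺ p zero    h = ∨-trueˡ _ h
  anyFin⁺ p (suc i) h = ∨-trueʳ (p zero) (anyFin⁺ (λ i → p (suc i)) i h)

  anyFin⁻ : ∀ {n} (p : Fin n → Bool) → anyFin p ≡ true → Σ (Fin n) λ i → p i ≡ true
  anyFin⁻ {zero}  p ()
  anyFin⁻ {suc n} p h with ∨-true⁻ (p zero) h
  ... | inj₁ h0 = zero , h0
  ... | inj₂ h1 with anyFin⁻ (λ i → p (suc i)) h1
  ... | i , hi = suc i , hi

  anyFin-false : ∀ {n} (p : Fin n → Bool) → anyFin p ≡ false → ∀ i → p i ≡ false
  anyFin-false p h i = ¬-not λ pi → not-¬ (anyFin⁺ p i pi) h

  anyL⁺ : ∀ {A : Set} (p : A → Bool) {xs : List A} {a} → a ∈ xs → p a ≡ true → anyL p xs ≡ true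
  anyL⁺ p (here refl) h = ∨-trueˡ _ h
  anyL⁺ p {x ∷ _} (there a∈xs) h = ∨-trueʳ (p x) (anyL⁺ p a∈xs h)

  anyL⁻ : ∀ {A : Set} (p : A → Bool) (xs : List A) → anyL p xs ≡ true → Σ A λ a → a ∈ xs × p a ≡ true
  anyL⁻ p []       ()
  anyL⁻ p (x ∷ xs) h with ∨-true⁻ (p x) h
  ... | inj₁ px = x , here refl , px
  ... | inj₂ h' with anyL⁻ p xs h'
  ... | a , a∈xs , pa = a , there a∈xs , pa

  anyL-cong : ∀ {A : Set} (p q : A → Bool) (xs : List A) → (∀ a → p a ≡ q a) → anyL p xs ≡ anyL q xs
  anyL-cong p q []       h = refl
  anyL-cong p q (x ∷ xs) h = cong₂ _∨_ (h x) (anyL-cong p q xs h)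

  -- Counting

  countFin-cong : ∀ {n} (p q : Fin n → Bool) → (∀ i → p i ≡ q i) → countFin p ≡ countFin q
  countFin-cong {zero}  p q h = refl
  countFin-cong {suc n} p q h =
    cong₂ (λ b r → (if b then 1 else 0) + r) (h zero) (countFin-cong _ _ (λ i → h (suc i)))

  countFin-mono : ∀ {n} (p q : Fin n → Bool) → (∀ i → p i ≡ true → q i ≡ true) → countFin p ≤ countFin q
  countFin-mono {zero}  p q h = z≤n
  countFin-mono {suc n} p q h with p zero in e | q zero in e'
  ... | true  | true  = s≤s (countFin-mono _ _ (λ i → h (suc i)))
  ... | true  | false = ⊥-elim (not-¬ (h zero e) e')
  ... | false | true  = ℕP.m≤n⇒m≤1+n (countFin-mono _ _ (λ i → h (suc i)))
  ... | false | false = countFin-mono _ _ (λ i → h (suc i))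

  countFin-≤ : ∀ {n} (p : Fin n → Bool) → countFin p ≤ n
  countFin-≤ {zero}  p = z≤n
  countFin-≤ {suc n} p with p zero
  ... | true  = s≤s (countFin-≤ (λ i → p (suc i)))
  ... | false = ℕP.m≤n⇒m≤1+n (countFin-≤ (λ i → p (suc i)))

  countFin-all : ∀ {n} (p : Fin n → Bool) → (∀ i → p i ≡ true) → countFin p ≡ n
  countFin-all {zero}  p h = refl
  countFin-all {suc n} p h rewrite h zero = cong suc (countFin-all _ (λ i → h (suc i)))

  countFin-none : ∀ {n} (p : Fin n → Bool) → (∀ i → p i ≡ false) → countFin p ≡ 0
  countFin-none {zero}  p h = refl
  countFin-none {suc n} p h rewrite h zero = countFin-none _ (λ i → h (suc i))

  countFin-split : ∀ {n} (p q : Fin n → Bool) →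
    countFin p ≡ countFin (λ i → p i ∧ q i) + countFin (λ i → p i ∧ not (q i))
  countFin-split {zero}  p q = refl
  countFin-split {suc n} p q with p zero | q zero
  ... | false | _     = countFin-split (λ i → p (suc i)) (λ i → q (suc i))
  ... | true  | true  = cong suc (countFin-split (λ i → p (suc i)) (λ i → q (suc i)))
  ... | true  | false = trans (cong suc (countFin-split (λ i → p (suc i)) (λ i → q (suc i)))) (sym (ℕP.+-suc _ _))

  countFin-remove : ∀ {n} (p : Fin n → Bool) (y : Fin n) → p y ≡ true →
    countFin p ≡ suc (countFin (λ i → p i ∧ not ⌊ i ≟ y ⌋))
  countFin-remove p zero h rewrite h =
    cong suc (countFin-cong (λ i → p (suc i)) _ (λ i → sym (∧-identityʳ _)))
  countFin-remove p (suc y) h with p zero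
  ... | true  = cong suc (trans (countFin-remove (λ i → p (suc i)) y h) (cong suc (countFin-cong _ _ suc-case)))
    where
    suc-case : ∀ i → p (suc i) ∧ not ⌊ i ≟ y ⌋ ≡ p (suc i) ∧ not ⌊ suc i ≟ suc y ⌋
    suc-case i = cong (λ b → p (suc i) ∧ not b) (sym (≟-suc i y))
  ... | false = trans (countFin-remove (λ i → p (suc i)) y h) (cong suc (countFin-cong _ _ suc-case))
    where
    suc-case : ∀ i → p (suc i) ∧ not ⌊ i ≟ y ⌋ ≡ p (suc i) ∧ not ⌊ suc i ≟ suc y ⌋
    suc-case i = cong (λ b → p (suc i) ∧ not b) (sym (≟-suc i y))

  countFin-pos : ∀ {n} (p : Fin n → Bool) (y : Fin n) → p y ≡ true → 1 ≤ countFin p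
  countFin-pos p y h rewrite countFin-remove p y h = s≤s z≤n

  countFin-singleton : ∀ {n} (p : Fin n → Bool) (x : Fin n) → p x ≡ true → (∀ y → p y ≡ true → y ≡ x) →
    countFin p ≡ 1
  countFin-singleton p x px unique rewrite countFin-remove p x px =
    cong suc (countFin-none _ λ i → ¬-not λ h →
      not-¬ (subst (λ z → ⌊ z ≟ x ⌋ ≡ true) (sym (unique i (∧-trueˡ (p i) h))) (≟-refl x))
            (not-true (∧-trueʳ (p i) h)))

  countFin-mono-< : ∀ {n} (p q : Fin n → Bool) (x : Fin n) → (∀ i → p i ≡ true → q i ≡ true) →
    q x ≡ true → p x ≡ false → suc (countFin p) ≤ countFin q
  countFin-mono-< p q x p⊆q qx px rewrite countFin-remove q x qx =
    s≤s (countFin-mono p _ λ i pi → ∧-true (p⊆q i pi) (cong not (≟-≢ λ { refl → not-¬ pi px })))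

  countFin-injection : ∀ {a b} (p : Fin a → Bool) (q : Fin b → Bool) (ψ : ∀ x → p x ≡ true → Fin b) →
    (∀ x px → q (ψ x px) ≡ true) → (∀ x y px py → ψ x px ≡ ψ y py → x ≡ y) →
    countFin p ≤ countFin q
  countFin-injection {zero}  p q ψ into inj = z≤n
  countFin-injection {suc a} p q ψ into inj with p zero in e
  ... | false = countFin-injection (λ i → p (suc i)) q (λ x → ψ (suc x)) (λ x → into (suc x))
                  (λ x y px py eq → suc-injective (inj (suc x) (suc y) px py eq))
  ... | true rewrite countFin-remove q (ψ zero e) (into zero e) =
    s≤s (countFin-injection (λ i → p (suc i)) _ (λ x → ψ (suc x))
          (λ x px → ∧-true (into (suc x) px) (cong not (≟-≢ λ eq → zero≢suc (inj (suc x) zero px e eq))))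
          (λ x y px py eq → suc-injective (inj (suc x) (suc y) px py eq)))
    where
    zero≢suc : ∀ {x : Fin a} → Fin.suc x ≢ zero
    zero≢suc ()

  countFin-involution : ∀ {n} (g : Fin n → Fin n) → (∀ z → g (g z) ≡ z) → (p q : Fin n → Bool) →
    (∀ z → p z ≡ true → q (g z) ≡ true) → (∀ z → q z ≡ true → p (g z) ≡ true) → countFin p ≡ countFin q
  countFin-involution g g-inv p q p→q q→p = ℕP.≤-antisym (via p q p→q) (via q p q→p)
    where
    via : ∀ p q → (∀ z → p z ≡ true → q (g z) ≡ true) → countFin p ≤ countFin q
    via p q p→q = countFin-injection p q (λ z _ → g z) p→q
      (λ z w _ _ e → trans (sym (g-inv z)) (trans (cong g e) (g-inv w)))

  _∈ᵇ_ : ∀ {N} → Fin N → List (Fin N) → Bool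
  z ∈ᵇ xs = anyL (λ x → ⌊ x ≟ z ⌋) xs

  ∈ᵇ⁺ : ∀ {N} {z : Fin N} {xs} → z ∈ xs → z ∈ᵇ xs ≡ true
  ∈ᵇ⁺ {z = z} z∈xs = anyL⁺ (λ x → ⌊ x ≟ z ⌋) z∈xs (≟-refl z)

  ∈ᵇ⁻ : ∀ {N} {z : Fin N} xs → z ∈ᵇ xs ≡ true → z ∈ xs
  ∈ᵇ⁻ {z = z} xs h with anyL⁻ (λ x → ⌊ x ≟ z ⌋) xs h
  ... | x , x∈xs , x≡z = subst (_∈ xs) (≟-sound x≡z) x∈xs

  ∉ᵇ : ∀ {N} {z : Fin N} xs → All (z ≢_) xs → z ∈ᵇ xs ≡ false
  ∉ᵇ xs z∉xs = ¬-not λ h → All.lookup z∉xs (∈ᵇ⁻ xs h) refl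

  countFin-∈ᵇ-∷ : ∀ {N} (x : Fin N) xs → x ∈ᵇ xs ≡ false →
    countFin (_∈ᵇ (x ∷ xs)) ≡ suc (countFin (_∈ᵇ xs))
  countFin-∈ᵇ-∷ x xs x∉xs =
    trans (countFin-remove (_∈ᵇ (x ∷ xs)) x (∨-trueˡ _ (≟-refl x))) (cong suc (countFin-cong _ _ drop-x))
    where
    drop-x : ∀ z → (z ∈ᵇ (x ∷ xs)) ∧ not ⌊ z ≟ x ⌋ ≡ z ∈ᵇ xs
    drop-x z with z ≟ x
    ... | yes refl = trans (∧-zeroʳ _) (sym x∉xs)
    ... | no z≢x rewrite ≟-≢ (λ x≡z → z≢x (sym x≡z)) = ∧-identityʳ _

  countFin-∈ᵇ-≤ : ∀ {N} (xs : List (Fin N)) → countFin (_∈ᵇ xs) ≤ length xs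
  countFin-∈ᵇ-≤ {N} [] = ℕP.≤-reflexive (countFin-none {N} (_∈ᵇ []) (λ _ → refl))
  countFin-∈ᵇ-≤ (x ∷ xs) with x ∈ᵇ xs in e
  ... | false = ℕP.≤-trans (ℕP.≤-reflexive (countFin-∈ᵇ-∷ x xs e)) (s≤s (countFin-∈ᵇ-≤ xs))
  ... | true  = ℕP.m≤n⇒m≤1+n (ℕP.≤-trans (ℕP.≤-reflexive (countFin-cong _ _ absorb)) (countFin-∈ᵇ-≤ xs))
    where
    absorb : ∀ z → z ∈ᵇ (x ∷ xs) ≡ z ∈ᵇ xs
    absorb z with x ≟ z
    ... | yes refl = sym e
    ... | no _     = refl

  countFin-∈ᵇ-unique : ∀ {N} {xs : List (Fin N)} → Unique xs → countFin (_∈ᵇ xs) ≡ length xs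
  countFin-∈ᵇ-unique {N} [] = countFin-none {N} (_∈ᵇ []) (λ _ → refl)
  countFin-∈ᵇ-unique {xs = x ∷ xs} (x∉xs ∷ u) =
    trans (countFin-∈ᵇ-∷ x xs (∉ᵇ xs x∉xs)) (cong suc (countFin-∈ᵇ-unique u))

  countFin-applyUpTo-or-repeat : ∀ {N} (f : ℕ → Fin N) m →
    countFin (_∈ᵇ applyUpTo f m) ≡ m ⊎ Σ ℕ λ i → Σ ℕ λ j → i < j × j < m × f i ≡ f j
  countFin-applyUpTo-or-repeat {N} f zero = inj₁ (countFin-none {N} _ (λ _ → refl))
  countFin-applyUpTo-or-repeat f (suc m) with countFin-applyUpTo-or-repeat (λ i → f (suc i)) m
  ... | inj₂ (i , j , i<j , j<m , eq) = inj₂ (suc i , suc j , s≤s i<j , s≤s j<m , eq)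
  ... | inj₁ count with f zero ∈ᵇ applyUpTo (λ i → f (suc i)) m in e
  ...   | false = inj₁ (trans (countFin-∈ᵇ-∷ (f zero) (applyUpTo (λ i → f (suc i)) m) e) (cong suc count))
  ...   | true with ∈-applyUpTo⁻ (λ i → f (suc i)) (∈ᵇ⁻ _ e)
  ...     | i , i<m , eq = inj₂ (zero , suc i , s≤s z≤n , s≤s i<m , eq)

  -- Orbits

  Holds : ∀ {n} → (Fin n → Fin n → Bool) → Rel (Fin n) 0ℓ
  Holds R x y = R x y ≡ true

  _∼[_]_ : ∀ {n} → Fin n → List (Fin n → Fin n) → Fin n → Set
  x ∼[ gs ] y = sameOrbit gs x y ≡ true

  Involutions : ∀ {n} → List (Fin n → Fin n) → Set
  Involutions {n} = All (λ g → ∀ (x : Fin n) → g (g x) ≡ x)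

  module _ {n : ℕ} (gs : List (Fin n → Fin n)) where

    reachIn-elim : (R : Fin n → Fin n → Set) → (∀ x → R x x) → All (λ g → ∀ x y → R (g x) y → R x y) gs →
      ∀ k x y → reachIn gs k x y ≡ true → R x y
    reachIn-elim R R-refl R-step zero x y h = subst (R x) (≟-sound h) (R-refl x)
    reachIn-elim R R-refl R-step (suc k) x y h with ∨-true⁻ ⌊ x ≟ y ⌋ h
    ... | inj₁ e = subst (R x) (≟-sound e) (R-refl x)
    ... | inj₂ h' with anyL⁻ _ gs h'
    ... | g , g∈gs , hg = All.lookup R-step g∈gs x y (reachIn-elim R R-refl R-step k (g x) y hg)

    reachIn-refl : ∀ k x → reachIn gs k x x ≡ true
    reachIn-refl zero    x = ≟-refl x
    reachIn-refl (suc k) x = ∨-trueˡ _ (≟-refl x)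

    reachIn-step : ∀ k {g} → g ∈ gs → ∀ x y → reachIn gs k (g x) y ≡ true → reachIn gs (suc k) x y ≡ true
    reachIn-step k g∈gs x y h = ∨-trueʳ ⌊ x ≟ y ⌋ (anyL⁺ (λ g → reachIn gs k (g x) y) g∈gs h)

    reachIn-mono : ∀ k l x y → k ≤ l → reachIn gs k x y ≡ true → reachIn gs l x y ≡ true
    reachIn-mono zero zero    x y _ h = h
    reachIn-mono zero (suc l) x y _ h = ∨-trueˡ _ h
    reachIn-mono (suc k) (suc l) x y (s≤s k≤l) h with ∨-true⁻ ⌊ x ≟ y ⌋ h
    ... | inj₁ e = ∨-trueˡ _ e
    ... | inj₂ h' with anyL⁻ _ gs h'
    ... | g , g∈gs , hg = reachIn-step l g∈gs x y (reachIn-mono k l (g x) y k≤l hg)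

    reachIn-suc : ∀ k x y → reachIn gs k x y ≡ true → reachIn gs (suc k) x y ≡ true
    reachIn-suc k x y = reachIn-mono k (suc k) x y (ℕP.n≤1+n k)

    reachIn-trans : ∀ k l x y z → reachIn gs k x y ≡ true → reachIn gs l y z ≡ true →
      reachIn gs (k + l) x z ≡ true
    reachIn-trans zero l x y z h₁ h₂ rewrite ≟-sound h₁ = h₂
    reachIn-trans (suc k) l x y z h₁ h₂ with ∨-true⁻ ⌊ x ≟ y ⌋ h₁
    ... | inj₁ e rewrite ≟-sound e = reachIn-mono l (suc k + l) y z (ℕP.m≤n+m l (suc k)) h₂
    ... | inj₂ h' with anyL⁻ _ gs h'
    ... | g , g∈gs , hg = reachIn-step (k + l) g∈gs x z (reachIn-trans k l (g x) y z hg h₂)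

    -- The sets {x | reachIn gs k x y} grow with k and stay fixed once two consecutive ones agree;
    -- since they cannot grow strictly n times inside Fin n, they are fixed from k = n on.
    module _ (y : Fin n) where
      private
        reaches : ℕ → Fin n → Bool
        reaches k x = reachIn gs k x y

        Stable : ℕ → Set
        Stable k = ∀ x → reaches (suc k) x ≡ reaches k x

        grows : ℕ → Bool
        grows k = anyFin (λ x → reaches (suc k) x ∧ not (reaches k x))

        stable-suc : ∀ k → Stable k → Stable (suc k)
        stable-suc k h x = cong (⌊ x ≟ y ⌋ ∨_) (anyL-cong _ _ gs (λ g → h (g x)))

        stable⇐ : ∀ k → grows k ≡ false → Stable k
        stable⇐ k h x with reaches k x in e
        ... | true = reachIn-suc k x y e
        ... | false with reaches (suc k) x in e'
        ... | true  = ⊥-elim (not-¬ (∧-true e' (cong not e)) (anyFin-false _ h x))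
        ... | false = refl

        stable⇒ : ∀ k → Stable k → grows k ≡ false
        stable⇒ k h = ¬-not λ g → let (x , hx) = anyFin⁻ _ g in
          not-¬ (trans (sym (h x)) (∧-trueˡ (reaches (suc k) x) hx)) (not-true (∧-trueʳ (reaches (suc k) x) hx))

        grows-pred : ∀ k → grows (suc k) ≡ true → grows k ≡ true
        grows-pred k h = ¬-not λ e → not-¬ h (stable⇒ (suc k) (stable-suc k (stable⇐ k e)))

        grows⇒size : ∀ k → grows k ≡ true → suc (suc k) ≤ countFin (reaches (suc k))
        grows⇒size k h = ℕP.≤-trans (s≤s (below k h)) (countFin-mono-< (reaches k) (reaches (suc k)) x
            (λ i → reachIn-suc k i y) (∧-trueˡ (reaches (suc k) x) hx) (not-true (∧-trueʳ (reaches (suc k) x) hx)))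
          where
          witness = anyFin⁻ (λ x → reaches (suc k) x ∧ not (reaches k x)) h
          x = proj₁ witness
          hx = proj₂ witness
          below : ∀ k → grows k ≡ true → suc k ≤ countFin (reaches k)
          below zero    _ = countFin-pos (reaches 0) y (≟-refl y)
          below (suc k) g = grows⇒size k (grows-pred k g)

        stable-n : ∀ j → Stable (j + n)
        stable-n zero = stable⇐ n (¬-not λ g →
          ℕP.<-irrefl refl (ℕP.≤-trans (grows⇒size n g) (ℕP.≤-trans (countFin-≤ (reaches (suc n))) (ℕP.n≤1+n n))))
        stable-n (suc j) = stable-suc (j + n) (stable-n j)

        reaches-n : ∀ j x → reaches (j + n) x ≡ reaches n x
        reaches-n zero    x = refl
        reaches-n (suc j) x = trans (stable-n j x) (reaches-n j x)

      reachIn⇒∼ : ∀ k x → reachIn gs k x y ≡ true → x ∼[ gs ] y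
      reachIn⇒∼ k x h = trans (sym (reaches-n k x)) (reachIn-mono k (k + n) x y (ℕP.m≤m+n k n) h)

    ∼-refl : ∀ x → x ∼[ gs ] x
    ∼-refl x = reachIn-refl n x

    ∼-trans : ∀ {x y z} → x ∼[ gs ] y → y ∼[ gs ] z → x ∼[ gs ] z
    ∼-trans {x} {y} {z} h₁ h₂ = reachIn⇒∼ z (n + n) x (reachIn-trans n n x y z h₁ h₂)

    ∼-step : ∀ {g} → g ∈ gs → ∀ {x y} → g x ∼[ gs ] y → x ∼[ gs ] y
    ∼-step g∈gs {x} {y} h = reachIn⇒∼ y (suc n) x (reachIn-step n g∈gs x y h)

    ∼-gen : ∀ {g} → g ∈ gs → ∀ x → x ∼[ gs ] g x
    ∼-gen g∈gs x = ∼-step g∈gs (∼-refl _)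

    ∼-elim : (R : Fin n → Fin n → Set) → (∀ x → R x x) → All (λ g → ∀ x y → R (g x) y → R x y) gs →
      ∀ {x y} → x ∼[ gs ] y → R x y
    ∼-elim R R-refl R-step {x} {y} = reachIn-elim R R-refl R-step n x y

    ∼-invariant : (P : Fin n → Set) → All (λ g → ∀ x → P x → P (g x)) gs → ∀ {x y} → x ∼[ gs ] y → P x → P y
    ∼-invariant P P-step = ∼-elim (λ x y → P x → P y) (λ _ p → p) (All.map (λ st x y h px → h (st x px)) P-step)

    ∼-sym : Involutions gs → ∀ {x y} → x ∼[ gs ] y → y ∼[ gs ] x
    ∼-sym invs = ∼-elim (λ x y → y ∼[ gs ] x) ∼-refl (All.tabulate back)
      where
      back : ∀ {g} → g ∈ gs → ∀ x y → y ∼[ gs ] g x → y ∼[ gs ] x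
      back {g} g∈gs x y h = ∼-trans h (subst (λ z → g x ∼[ gs ] z) (All.lookup invs g∈gs x) (∼-gen g∈gs (g x)))

    ∼-isEquivalence : Involutions gs → IsEquivalence (Holds (sameOrbit gs))
    ∼-isEquivalence invs = record { refl = ∼-refl _ ; sym = ∼-sym invs ; trans = ∼-trans }

  ∼-map : ∀ {a b} (gs : List (Fin a → Fin a)) (hs : List (Fin b → Fin b)) (φ : Fin a → Fin b) →
    All (λ g → ∀ x → φ x ∼[ hs ] φ (g x)) gs → ∀ {x y} → x ∼[ gs ] y → φ x ∼[ hs ] φ y
  ∼-map gs hs φ φ-step = ∼-elim gs (λ x y → φ x ∼[ hs ] φ y) (λ x → ∼-refl hs (φ x))
    (All.map (λ st x y h → ∼-trans hs (st x) h) φ-step)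

  -- Equivalence classes

  isClassRep : ∀ {N} → (Fin N → Fin N → Bool) → Fin N → Bool
  isClassRep R i = not (anyFin (λ j → (toℕ j <ᵇ toℕ i) ∧ R j i))

  numClasses : ∀ {N} → (Fin N → Fin N → Bool) → (Fin N → Bool) → ℕ
  numClasses R P = countFin (λ i → isClassRep R i ∧ P i)

  module Classes {N : ℕ} (R : Fin N → Fin N → Bool) (E : IsEquivalence (Holds R)) where
    open IsEquivalence E renaming (refl to R-refl; sym to R-sym; trans to R-trans)

    rep-least : ∀ {i j} → isClassRep R i ≡ true → R j i ≡ true → toℕ i ≤ toℕ j
    rep-least {i} {j} rep-i rji with toℕ j <ᵇ toℕ i in e
    ... | true  = ⊥-elim (not-¬ (anyFin⁺ (λ j → (toℕ j <ᵇ toℕ i) ∧ R j i) j (∧-true e rji)) (not-true rep-i))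
    ... | false = ℕP.≮⇒≥ (λ lt → not-¬ (<⇒<ᵇ lt) e)

    rep-unique : ∀ {r r'} → isClassRep R r ≡ true → isClassRep R r' ≡ true → R r r' ≡ true → r ≡ r'
    rep-unique rep-r rep-r' rr' = toℕ-injective (ℕP.≤-antisym (rep-least rep-r (R-sym rr')) (rep-least rep-r' rr'))

    private
      repBelow : ∀ b x → toℕ x < b → Σ (Fin N) λ r → isClassRep R r ≡ true × R r x ≡ true
      repBelow (suc b) x lt with isClassRep R x in e
      ... | true  = x , e , R-refl
      ... | false with anyFin⁻ (λ j → (toℕ j <ᵇ toℕ x) ∧ R j x) (¬-not λ e' → not-¬ (cong not e') e)
      ... | j , hj with repBelow b j (ℕP.<-≤-trans (<ᵇ⇒< (∧-trueˡ _ hj)) (ℕP.≤-pred lt))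
      ... | r , rep-r , rrj = r , rep-r , R-trans rrj (∧-trueʳ (toℕ j <ᵇ toℕ x) hj)

    rep : Fin N → Fin N
    rep x = proj₁ (repBelow N x (toℕ<n x))

    rep-isClassRep : ∀ x → isClassRep R (rep x) ≡ true
    rep-isClassRep x = proj₁ (proj₂ (repBelow N x (toℕ<n x)))

    rep-rel : ∀ x → R (rep x) x ≡ true
    rep-rel x = proj₂ (proj₂ (repBelow N x (toℕ<n x)))

    rep-cong : ∀ {x y} → R x y ≡ true → rep x ≡ rep y
    rep-cong {x} {y} h = rep-unique (rep-isClassRep x) (rep-isClassRep y) (R-trans (rep-rel x) (R-trans h (R-sym (rep-rel y))))

    rep-idem : ∀ {r} → isClassRep R r ≡ true → rep r ≡ r
    rep-idem {r} h = rep-unique (rep-isClassRep r) h (rep-rel r)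

    rep-injective : ∀ {x y} → rep x ≡ rep y → R x y ≡ true
    rep-injective {x} {y} e = R-trans (R-sym (rep-rel x)) (subst (λ z → R z y ≡ true) (sym e) (rep-rel y))

  numClasses-surjection : ∀ {a b} (R : Fin a → Fin a → Bool) (R' : Fin b → Fin b → Bool) →
    IsEquivalence (Holds R) → IsEquivalence (Holds R') →
    (P : Fin a → Bool) (Q : Fin b → Bool) (φ : Fin a → Fin b) →
    (∀ {x y} → P x ≡ true → R x y ≡ true → R' (φ x) (φ y) ≡ true) →
    (∀ {x y} → R x y ≡ true → P x ≡ true → P y ≡ true) →
    (∀ y → Q y ≡ true → Σ (Fin a) λ x → P x ≡ true × R' (φ x) y ≡ true) →
    numClasses R' Q ≤ numClasses R P
  numClasses-surjection {a} R R' E E' P Q φ φ-resp P-resp onto = countFin-injection _ _ ψ into injective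
    where
    open Classes R E
    module E' = IsEquivalence E'
    preimage : ∀ y → isClassRep R' y ∧ Q y ≡ true → Σ (Fin a) λ x → P x ≡ true × R' (φ x) y ≡ true
    preimage y hy = onto y (∧-trueʳ (isClassRep R' y) hy)
    ψ : ∀ y → isClassRep R' y ∧ Q y ≡ true → Fin a
    ψ y hy = rep (proj₁ (preimage y hy))
    into : ∀ y hy → isClassRep R (ψ y hy) ∧ P (ψ y hy) ≡ true
    into y hy = ∧-true (rep-isClassRep _) (P-resp (IsEquivalence.sym E (rep-rel _)) (proj₁ (proj₂ (preimage y hy))))
    injective : ∀ y₁ y₂ h₁ h₂ → ψ y₁ h₁ ≡ ψ y₂ h₂ → y₁ ≡ y₂
    injective y₁ y₂ h₁ h₂ eq = Classes.rep-unique R' E' (∧-trueˡ _ h₁) (∧-trueˡ _ h₂)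
      (E'.trans (E'.sym (proj₂ (proj₂ (preimage y₁ h₁))))
        (E'.trans (φ-resp (proj₁ (proj₂ (preimage y₁ h₁))) (rep-injective eq)) (proj₂ (proj₂ (preimage y₂ h₂)))))

  sumFin : ∀ {N} → (Fin N → ℕ) → ℕ
  sumFin {zero}  f = 0
  sumFin {suc N} f = f zero + sumFin (λ i → f (suc i))

  sumFin-cong : ∀ {N} (f g : Fin N → ℕ) → (∀ i → f i ≡ g i) → sumFin f ≡ sumFin g
  sumFin-cong {zero}  f g h = refl
  sumFin-cong {suc N} f g h = cong₂ _+_ (h zero) (sumFin-cong _ _ (λ i → h (suc i)))

  sumFin-mono : ∀ {N} (f g : Fin N → ℕ) → (∀ i → f i ≤ g i) → sumFin f ≤ sumFin g
  sumFin-mono {zero}  f g h = z≤n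
  sumFin-mono {suc N} f g h = ℕP.+-mono-≤ (h zero) (sumFin-mono _ _ (λ i → h (suc i)))

  sumFin-+ : ∀ {N} (f g : Fin N → ℕ) → sumFin (λ i → f i + g i) ≡ sumFin f + sumFin g
  sumFin-+ {zero}  f g = refl
  sumFin-+ {suc N} f g =
    trans (cong ((f zero + g zero) +_) (sumFin-+ (λ i → f (suc i)) (λ i → g (suc i)))) (medial (f zero) (g zero) _ _)
    where
    medial : ∀ a b c d → (a + b) + (c + d) ≡ (a + c) + (b + d)
    medial = solve-∀

  sumFin-zero : ∀ N → sumFin {N} (λ _ → 0) ≡ 0
  sumFin-zero zero    = refl
  sumFin-zero (suc N) = sumFin-zero N

  sumFin-swap : ∀ {a b} (f : Fin a → Fin b → ℕ) →
    sumFin (λ i → sumFin (λ j → f i j)) ≡ sumFin (λ j → sumFin (λ i → f i j))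
  sumFin-swap {zero}  {b} f = sym (sumFin-zero b)
  sumFin-swap {suc a} f = trans (cong (sumFin (f zero) +_) (sumFin-swap (λ i → f (suc i))))
                                (sym (sumFin-+ (f zero) (λ j → sumFin (λ i → f (suc i) j))))

  indicator : Bool → ℕ
  indicator b = if b then 1 else 0

  countFin≡sumFin : ∀ {N} (p : Fin N → Bool) → countFin p ≡ sumFin (λ i → indicator (p i))
  countFin≡sumFin {zero}  p = refl
  countFin≡sumFin {suc N} p = cong (indicator (p zero) +_) (countFin≡sumFin (λ i → p (suc i)))

  sumFin-const : ∀ {N} (p : Fin N → Bool) (s : ℕ) → sumFin (λ i → if p i then s else 0) ≡ s * countFin p
  sumFin-const {zero}  p s = sym (ℕP.*-zeroʳ s)
  sumFin-const {suc N} p s with p zero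
  ... | true  = trans (cong (s +_) (sumFin-const (λ i → p (suc i)) s)) (sym (ℕP.*-suc s _))
  ... | false = sumFin-const (λ i → p (suc i)) s

  countFin-∧ˡ : ∀ {N} (a : Bool) (q : Fin N → Bool) → countFin (λ j → a ∧ q j) ≡ (if a then countFin q else 0)
  countFin-∧ˡ true  q = refl
  countFin-∧ˡ false q = countFin-none (λ j → false ∧ q j) (λ _ → refl)

  module Fibres {N : ℕ} (R : Fin N → Fin N → Bool) (E : IsEquivalence (Holds R))
                (P : Fin N → Bool) (P-resp : ∀ {x y} → R x y ≡ true → P x ≡ true → P y ≡ true)
                (W : Fin N → Bool) where
    open IsEquivalence E using () renaming (sym to R-sym; trans to R-trans)
    open Classes R E

    classSize : Fin N → ℕ
    classSize i = countFin (λ j → R i j ∧ W j)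

    countFin-fibres : countFin (λ j → P j ∧ W j) ≡ sumFin (λ i → if isClassRep R i ∧ P i then classSize i else 0)
    countFin-fibres = begin
        countFin (λ j → P j ∧ W j)
      ≡⟨ countFin≡sumFin (λ j → P j ∧ W j) ⟩
        sumFin (λ j → indicator (P j ∧ W j))
      ≡⟨ sumFin-cong _ _ (λ j → sym (trans (sym (countFin≡sumFin (member j))) (count-member j))) ⟩
        sumFin (λ j → sumFin (λ i → indicator (member j i)))
      ≡⟨ sumFin-swap (λ j i → indicator (member j i)) ⟩
        sumFin (λ i → sumFin (λ j → indicator (member j i)))
      ≡⟨ sumFin-cong _ _ (λ i → trans (sym (countFin≡sumFin (λ j → member j i)))
                                      (countFin-∧ˡ (isClassRep R i ∧ P i) (λ j → R i j ∧ W j))) ⟩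
        sumFin (λ i → if isClassRep R i ∧ P i then classSize i else 0)
      ∎
      where
      open ≡-Reasoning
      member : Fin N → Fin N → Bool
      member j i = (isClassRep R i ∧ P i) ∧ (R i j ∧ W j)
      count-member : ∀ j → countFin (member j) ≡ indicator (P j ∧ W j)
      count-member j with P j ∧ W j in e
      ... | true  = countFin-singleton (member j) (rep j)
          (∧-true (∧-true (rep-isClassRep j) (P-resp (R-sym (rep-rel j)) (∧-trueˡ (P j) e)))
                  (∧-true (rep-rel j) (∧-trueʳ (P j) e)))
          (λ i hi → rep-unique (∧-trueˡ _ (∧-trueˡ _ hi)) (rep-isClassRep j)
                       (R-trans (∧-trueˡ _ (∧-trueʳ (isClassRep R i ∧ P i) hi)) (R-sym (rep-rel j))))
      ... | false = countFin-none (member j) λ i → ¬-not λ hi → not-¬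
          (∧-true (P-resp (∧-trueˡ _ (∧-trueʳ (isClassRep R i ∧ P i) hi)) (∧-trueʳ (isClassRep R i) (∧-trueˡ _ hi)))
                  (∧-trueʳ (R i j) (∧-trueʳ (isClassRep R i ∧ P i) hi)))
          e

    countFin-fibres-≥ : (s : ℕ) → (∀ i → isClassRep R i ≡ true → P i ≡ true → s ≤ classSize i) →
      s * numClasses R P ≤ countFin (λ j → P j ∧ W j)
    countFin-fibres-≥ s big = begin
        s * numClasses R P
      ≡⟨ sym (sumFin-const (λ i → isClassRep R i ∧ P i) s) ⟩
        sumFin (λ i → if isClassRep R i ∧ P i then s else 0)
      ≤⟨ sumFin-mono _ _ each ⟩
        sumFin (λ i → if isClassRep R i ∧ P i then classSize i else 0)
      ≡⟨ sym countFin-fibres ⟩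
        countFin (λ j → P j ∧ W j)
      ∎
      where
      open ℕP.≤-Reasoning
      each : ∀ i → (if isClassRep R i ∧ P i then s else 0) ≤ (if isClassRep R i ∧ P i then classSize i else 0)
      each i with isClassRep R i in e₁ | P i in e₂
      ... | true  | true  = big i e₁ e₂
      ... | true  | false = z≤n
      ... | false | _     = z≤n

    countFin-fibres-≡ : (s : ℕ) → (∀ i → isClassRep R i ≡ true → P i ≡ true → classSize i ≡ s) →
      countFin (λ j → P j ∧ W j) ≡ s * numClasses R P
    countFin-fibres-≡ s exact =
      trans countFin-fibres (trans (sumFin-cong _ _ each) (sumFin-const (λ i → isClassRep R i ∧ P i) s))
      where
      each : ∀ i → (if isClassRep R i ∧ P i then classSize i else 0) ≡ (if isClassRep R i ∧ P i then s else 0)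
      each i with isClassRep R i in e₁ | P i in e₂
      ... | true  | true  = exact i e₁ e₂
      ... | true  | false = refl
      ... | false | _     = refl

  leastTrue : (p : ℕ → Bool) → ∀ k → p k ≡ true → Σ ℕ λ m → p m ≡ true × (∀ j → j < m → p j ≡ false)
  leastTrue p k pk with search (suc k)
    where
    search : ∀ k → (∀ j → j < k → p j ≡ false) ⊎ (Σ ℕ λ m → p m ≡ true × (∀ j → j < m → p j ≡ false))
    search zero = inj₁ (λ _ ())
    search (suc k) with search k
    ... | inj₂ found = inj₂ found
    ... | inj₁ none with p k in e
    ...   | true  = inj₂ (k , e , none)
    ...   | false = inj₁ λ j j<1+k → case-≤ j (ℕP.m≤n⇒m<n∨m≡n (ℕP.≤-pred j<1+k))
      where
      case-≤ : ∀ j → j < k ⊎ j ≡ k → p j ≡ false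
      case-≤ j (inj₁ j<k)  = none j j<k
      case-≤ j (inj₂ refl) = e
  ... | inj₁ none  = ⊥-elim (not-¬ pk (none k ℕP.≤-refl))
  ... | inj₂ found = found

  module Merging {N : ℕ} (B T : Fin N → Fin N → Bool) (EB : IsEquivalence (Holds B)) (ET : IsEquivalence (Holds T))
                 (hub : Fin N → Fin N) (isBridge : Fin N → Bool) where
    module EB = IsEquivalence EB
    module ET = IsEquivalence ET
    module CB = Classes B EB
    module CT = Classes T ET

    -- x and y are joined by B-steps and at most k bridges z — hub z with isBridge z, crossed in either direction.
    linked : ℕ → Fin N → Fin N → Bool
    linked zero    x y = B x y
    linked (suc k) x y = B x y ∨ anyFin (λ z → B x z ∧ ((isBridge z ∧ linked k (hub z) y) ∨
                                                        anyFin (λ s → (isBridge s ∧ ⌊ hub s ≟ z ⌋) ∧ linked k s y)))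

    linked-B : ∀ k {x' x y} → B x' x ≡ true → linked k x y ≡ true → linked k x' y ≡ true
    linked-B zero    b l = EB.trans b l
    linked-B (suc k) {x'} {x} {y} b l with ∨-true⁻ (B x y) l
    ... | inj₁ bxy = ∨-trueˡ _ (EB.trans b bxy)
    ... | inj₂ l' with anyFin⁻ _ l'
    ... | z , hz = ∨-trueʳ (B x' y) (anyFin⁺ _ z (∧-true (EB.trans b (∧-trueˡ (B x z) hz)) (∧-trueʳ (B x z) hz)))

    linked-out : ∀ k {x z y} → isBridge z ≡ true → B x z ≡ true → linked k (hub z) y ≡ true → linked (suc k) x y ≡ true
    linked-out k {x} {z} {y} sz b l = ∨-trueʳ (B x y) (anyFin⁺ _ z (∧-true b (∨-trueˡ _ (∧-true sz l))))

    linked-in : ∀ k {x s y} → isBridge s ≡ true → B x (hub s) ≡ true → linked k s y ≡ true → linked (suc k) x y ≡ true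
    linked-in k {x} {s} {y} ss b l = ∨-trueʳ (B x y) (anyFin⁺ _ (hub s) (∧-true b
      (∨-trueʳ (isBridge (hub s) ∧ linked k (hub (hub s)) y) (anyFin⁺ _ s (∧-true (∧-true ss (≟-refl (hub s))) l)))))

    data FirstBridge (k : ℕ) (x y : Fin N) : Set where
      out : ∀ z → isBridge z ≡ true → B x z ≡ true → linked k (hub z) y ≡ true → FirstBridge k x y
      in′ : ∀ s → isBridge s ≡ true → B x (hub s) ≡ true → linked k s y ≡ true → FirstBridge k x y

    firstBridge : ∀ k {x y} → linked (suc k) x y ≡ true → B x y ≡ true ⊎ FirstBridge k x y
    firstBridge k {x} {y} l with ∨-true⁻ (B x y) l
    ... | inj₁ b = inj₁ b
    ... | inj₂ l' with anyFin⁻ _ l'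
    ... | z , hz with ∨-true⁻ (isBridge z ∧ linked k (hub z) y) (∧-trueʳ (B x z) hz)
    ... | inj₁ o = inj₂ (out z (∧-trueˡ (isBridge z) o) (∧-trueˡ (B x z) hz) (∧-trueʳ (isBridge z) o))
    ... | inj₂ i with anyFin⁻ _ i
    ... | s , hs = inj₂ (in′ s (∧-trueˡ (isBridge s) (∧-trueˡ _ hs))
                     (subst (λ w → B x w ≡ true) (sym (≟-sound (∧-trueʳ (isBridge s) (∧-trueˡ _ hs)))) (∧-trueˡ (B x z) hz))
                     (∧-trueʳ (isBridge s ∧ ⌊ hub s ≟ z ⌋) hs))

    linked-suc : ∀ k {x y} → linked k x y ≡ true → linked (suc k) x y ≡ true
    linked-suc zero    l = ∨-trueˡ _ l
    linked-suc (suc k) l with firstBridge k l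
    ... | inj₁ b = ∨-trueˡ _ b
    ... | inj₂ (out z sz b l') = linked-out (suc k) sz b (linked-suc k l')
    ... | inj₂ (in′ s ss b l') = linked-in (suc k) ss b (linked-suc k l')

    linked-mono : ∀ k l {x y} → k ≤ l → linked k x y ≡ true → linked l x y ≡ true
    linked-mono k l {x} {y} k≤l lk with ℕP.m≤n⇒∃[o]m+o≡n k≤l
    ... | o , refl = go o
      where
      go : ∀ o → linked (k + o) x y ≡ true
      go zero    rewrite ℕP.+-identityʳ k = lk
      go (suc o) rewrite ℕP.+-suc k o = linked-suc (k + o) (go o)

    linked-trans : ∀ k l {x y z} → linked k x y ≡ true → linked l y z ≡ true → linked (k + l) x z ≡ true
    linked-trans zero    l b  l₂ = linked-B l b l₂
    linked-trans (suc k) l l₁ l₂ with firstBridge k l₁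
    ... | inj₁ b = linked-mono l (suc k + l) (ℕP.m≤n+m l (suc k)) (linked-B l b l₂)
    ... | inj₂ (out z sz b l') = linked-out (k + l) sz b (linked-trans k l l' l₂)
    ... | inj₂ (in′ s ss b l') = linked-in (k + l) ss b (linked-trans k l l' l₂)

    Linked : Fin N → Fin N → Set
    Linked x y = Σ ℕ λ k → linked k x y ≡ true

    Linked-B : ∀ {x y} → B x y ≡ true → Linked x y
    Linked-B b = zero , b

    Linked-trans : ∀ {x y z} → Linked x y → Linked y z → Linked x z
    Linked-trans (k , l₁) (l , l₂) = k + l , linked-trans k l l₁ l₂

    Linked-out : ∀ {z} → isBridge z ≡ true → Linked z (hub z)
    Linked-out sz = 1 , linked-out 0 sz EB.refl EB.refl

    Linked-in : ∀ {s} → isBridge s ≡ true → Linked (hub s) s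
    Linked-in ss = 1 , linked-in 0 ss EB.refl EB.refl

    -- Each B-class that is not a T-class is sent to the first bridge of a shortest linking path from its
    -- representative r to the T-representative of r; minimality of the path makes this injective.
    module _ (B⊆T : ∀ {x y} → B x y ≡ true → T x y ≡ true)
             (bridge⊆T : ∀ z → isBridge z ≡ true → T z (hub z) ≡ true)
             (T⊆Linked : ∀ {x y} → T x y ≡ true → Linked x y) where

      record Shortest (r : Fin N) : Set where
        field
          steps    : ℕ
          shortest : ∀ j → j < suc steps → linked j r (CT.rep r) ≡ false
          bridge   : FirstBridge steps r (CT.rep r)

      notBridged : ∀ r → isClassRep B r ≡ true → isClassRep T r ≡ false → B r (CT.rep r) ≡ false
      notBridged r rep-B not-rep-T = ¬-not λ b → not-¬
        (subst (λ z → isClassRep T z ≡ true)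
          (sym (toℕ-injective (ℕP.≤-antisym (CB.rep-least rep-B (EB.sym b)) (CT.rep-least (CT.rep-isClassRep r) (B⊆T b)))))
          (CT.rep-isClassRep r))
        not-rep-T

      shortestPath : ∀ r → isClassRep B r ≡ true → isClassRep T r ≡ false → Shortest r
      shortestPath r rep-B not-rep-T with T⊆Linked (ET.sym (CT.rep-rel r))
      ... | K , lK with leastTrue (λ j → linked j r (CT.rep r)) K lK
      ... | zero  , l0 , _  = ⊥-elim (not-¬ l0 (notBridged r rep-B not-rep-T))
      ... | suc k , l , min with firstBridge k l
      ... | inj₁ b  = ⊥-elim (not-¬ b (notBridged r rep-B not-rep-T))
      ... | inj₂ fb = record { steps = k ; shortest = min ; bridge = fb }

      bridgeOf : ∀ {r} → Shortest r → Fin N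
      bridgeOf p with Shortest.bridge p
      ... | out z _ _ _ = z
      ... | in′ s _ _ _ = s

      bridgeOf-isBridge : ∀ {r} (p : Shortest r) → isBridge (bridgeOf p) ≡ true
      bridgeOf-isBridge p with Shortest.bridge p
      ... | out _ sz _ _ = sz
      ... | in′ _ ss _ _ = ss

      bridgeOf-T : ∀ {r} (p : Shortest r) → T r (bridgeOf p) ≡ true
      bridgeOf-T p with Shortest.bridge p
      ... | out _ _  b _ = B⊆T b
      ... | in′ s ss b _ = ET.trans (B⊆T b) (ET.sym (bridge⊆T s ss))

      crossing : ∀ {r₁ r₂ e} (p₁ : Shortest r₁) (p₂ : Shortest r₂) → CT.rep r₁ ≡ CT.rep r₂ →
        B r₁ e ≡ true → linked (Shortest.steps p₁) (hub e) (CT.rep r₁) ≡ true →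
        B r₂ (hub e) ≡ true → linked (Shortest.steps p₂) e (CT.rep r₂) ≡ true → ⊥
      crossing {r₁} {r₂} p₁ p₂ same b₁ l₁ b₂ l₂ = ℕP.<-irrefl refl (ℕP.<-trans shorter₂ shorter₁)
        where
        l₂₁ : linked (Shortest.steps p₁) r₂ (CT.rep r₂) ≡ true
        l₂₁ = subst (λ t → linked (Shortest.steps p₁) r₂ t ≡ true) same (linked-B (Shortest.steps p₁) b₂ l₁)
        l₁₂ : linked (Shortest.steps p₂) r₁ (CT.rep r₁) ≡ true
        l₁₂ = subst (λ t → linked (Shortest.steps p₂) r₁ t ≡ true) (sym same) (linked-B (Shortest.steps p₂) b₁ l₂)
        shorter₂ : Shortest.steps p₂ < Shortest.steps p₁
        shorter₂ = ℕP.≮⇒≥ (λ lt → not-¬ l₂₁ (Shortest.shortest p₂ _ lt))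
        shorter₁ : Shortest.steps p₁ < Shortest.steps p₂
        shorter₁ = ℕP.≮⇒≥ (λ lt → not-¬ l₁₂ (Shortest.shortest p₁ _ lt))

      bridgeOf-injective : ∀ {r₁ r₂} → isClassRep B r₁ ≡ true → isClassRep B r₂ ≡ true →
        (p₁ : Shortest r₁) (p₂ : Shortest r₂) → bridgeOf p₁ ≡ bridgeOf p₂ → r₁ ≡ r₂
      bridgeOf-injective {r₁} {r₂} rep₁ rep₂ p₁ p₂ e = go (Shortest.bridge p₁) (Shortest.bridge p₂) refl refl
        where
        same : CT.rep r₁ ≡ CT.rep r₂
        same = CT.rep-cong (ET.trans (bridgeOf-T p₁) (subst (λ z → T z r₂ ≡ true) (sym e) (ET.sym (bridgeOf-T p₂))))
        go : ∀ q₁ q₂ → Shortest.bridge p₁ ≡ q₁ → Shortest.bridge p₂ ≡ q₂ → r₁ ≡ r₂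
        go (out z₁ _ b₁ l₁) (out z₂ _ b₂ l₂) refl refl =
          CB.rep-unique rep₁ rep₂ (EB.trans b₁ (EB.sym (subst (λ z → B r₂ z ≡ true) (sym e) b₂)))
        go (in′ s₁ _ b₁ l₁) (in′ s₂ _ b₂ l₂) refl refl =
          CB.rep-unique rep₁ rep₂ (EB.trans b₁ (EB.sym (subst (λ z → B r₂ (hub z) ≡ true) (sym e) b₂)))
        go (out z₁ _ b₁ l₁) (in′ s₂ _ b₂ l₂) refl refl =
          ⊥-elim (crossing p₁ p₂ same b₁ l₁ (subst (λ z → B r₂ (hub z) ≡ true) (sym e) b₂)
                                          (subst (λ z → linked (Shortest.steps p₂) z (CT.rep r₂) ≡ true) (sym e) l₂))
        go (in′ s₁ _ b₁ l₁) (out z₂ _ b₂ l₂) refl refl =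
          ⊥-elim (crossing p₂ p₁ (sym same) b₂ l₂ (subst (λ z → B r₁ (hub z) ≡ true) e b₁)
                                                (subst (λ z → linked (Shortest.steps p₁) z (CT.rep r₁) ≡ true) e l₁))

      numClasses-merge : numClasses B (λ _ → true) ≤ numClasses T (λ _ → true) + countFin isBridge
      numClasses-merge = begin
          numClasses B (λ _ → true)
        ≡⟨ countFin-split (λ i → isClassRep B i ∧ true) (isClassRep T) ⟩
          countFin (λ i → (isClassRep B i ∧ true) ∧ isClassRep T i) +
          countFin (λ i → (isClassRep B i ∧ true) ∧ not (isClassRep T i))
        ≤⟨ ℕP.+-mono-≤ (countFin-mono _ _ (λ i hi → ∧-true (∧-trueʳ (isClassRep B i ∧ true) hi) refl))
                       (countFin-injection _ isBridge ψ (λ r hr → bridgeOf-isBridge (path r hr))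
                          (λ r₁ r₂ h₁ h₂ → bridgeOf-injective (rep-B r₁ h₁) (rep-B r₂ h₂) (path r₁ h₁) (path r₂ h₂))) ⟩
          numClasses T (λ _ → true) + countFin isBridge
        ∎
        where
        open ℕP.≤-Reasoning
        rep-B : ∀ r → (isClassRep B r ∧ true) ∧ not (isClassRep T r) ≡ true → isClassRep B r ≡ true
        rep-B r hr = ∧-trueˡ (isClassRep B r) (∧-trueˡ _ hr)
        path : ∀ r → (isClassRep B r ∧ true) ∧ not (isClassRep T r) ≡ true → Shortest r
        path r hr = shortestPath r (rep-B r hr) (not-true (∧-trueʳ (isClassRep B r ∧ true) hr))
        ψ : ∀ r → (isClassRep B r ∧ true) ∧ not (isClassRep T r) ≡ true → Fin N
        ψ r hr = bridgeOf (path r hr)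

  -- Orbits of two involutions

  module _ {N : ℕ} (u v : Fin N → Fin N) (u-inv : ∀ z → u (u z) ≡ z) (v-inv : ∀ z → v (v z) ≡ z)
           (uv≡vu : ∀ z → u (v z) ≡ v (u z)) (x : Fin N)
           (ux≢x : u x ≢ x) (vx≢x : v x ≢ x) (uvx≢x : u (v x) ≢ x) (uvx≢vx : u (v x) ≢ v x) where
    private
      square : List (Fin N)
      square = x ∷ u x ∷ v x ∷ u (v x) ∷ []

      u-square : ∀ z → z ∈ square → u z ∈ square
      u-square _ (here refl)                         = there (here refl)
      u-square _ (there (here refl))                 = here (u-inv x)
      u-square _ (there (there (here refl)))         = there (there (there (here refl)))
      u-square _ (there (there (there (here refl)))) = there (there (here (u-inv (v x))))

      v-square : ∀ z → z ∈ square → v z ∈ square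
      v-square _ (here refl)                         = there (there (here refl))
      v-square _ (there (here refl))                 = there (there (there (here (sym (uv≡vu x)))))
      v-square _ (there (there (here refl)))         = here (v-inv x)
      v-square _ (there (there (there (here refl)))) = there (here (trans (sym (uv≡vu (v x))) (cong u (v-inv x))))

      square-orbit : ∀ {z} → z ∈ square → x ∼[ u ∷ v ∷ [] ] z
      square-orbit (here refl)                         = ∼-refl (u ∷ v ∷ []) x
      square-orbit (there (here refl))                 = ∼-gen (u ∷ v ∷ []) (here refl) x
      square-orbit (there (there (here refl)))         = ∼-gen (u ∷ v ∷ []) (there (here refl)) x
      square-orbit (there (there (there (here refl)))) =
        ∼-trans (u ∷ v ∷ []) (∼-gen (u ∷ v ∷ []) (there (here refl)) x) (∼-gen (u ∷ v ∷ []) (here refl) (v x))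

      square-unique : Unique square
      square-unique = ((λ e → ux≢x (sym e)) ∷ (λ e → vx≢x (sym e)) ∷ (λ e → uvx≢x (sym e)) ∷ [])
                    ∷ (ux≢vx ∷ ux≢uvx ∷ [])
                    ∷ ((λ e → uvx≢vx (sym e)) ∷ [])
                    ∷ [] ∷ []
        where
        ux≢vx : u x ≢ v x
        ux≢vx e = uvx≢x (trans (cong u (sym e)) (u-inv x))
        ux≢uvx : u x ≢ u (v x)
        ux≢uvx e = vx≢x (sym (trans (sym (u-inv x)) (trans (cong u e) (u-inv (v x)))))

    orbit-size-4 : countFin (sameOrbit (u ∷ v ∷ []) x) ≡ 4
    orbit-size-4 = trans (countFin-cong (sameOrbit (u ∷ v ∷ []) x) (_∈ᵇ square) λ z → Bool-ext (λ o → ∈ᵇ⁺ (orbit-square o)) (λ m → square-orbit (∈ᵇ⁻ square m)))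
                         (countFin-∈ᵇ-unique square-unique)
      where
      orbit-square : ∀ {z} → x ∼[ u ∷ v ∷ [] ] z → z ∈ square
      orbit-square o = ∼-invariant (u ∷ v ∷ []) (_∈ square) (u-square ∷ v-square ∷ []) o (here refl)

  isLower : ∀ {N} → (Fin N → Fin N) → Fin N → Bool
  isLower g x = toℕ x <ᵇ toℕ (g x)

  countFin-half : ∀ {N} (g : Fin N → Fin N) → (∀ z → g (g z) ≡ z) → (∀ z → g z ≢ z) → (P : Fin N → Bool) →
    (∀ z → P z ≡ true → P (g z) ≡ true) → 2 * countFin (λ z → P z ∧ isLower g z) ≡ countFin P
  countFin-half g g-inv g-fpf P P-resp = begin
      2 * countFin (λ z → P z ∧ isLower g z)
    ≡⟨ cong (countFin (λ z → P z ∧ isLower g z) +_) (ℕP.+-identityʳ _) ⟩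
      countFin (λ z → P z ∧ isLower g z) + countFin (λ z → P z ∧ isLower g z)
    ≡⟨ cong (countFin (λ z → P z ∧ isLower g z) +_) (countFin-involution g g-inv _ _ lower→upper upper→lower) ⟩
      countFin (λ z → P z ∧ isLower g z) + countFin (λ z → P z ∧ not (isLower g z))
    ≡⟨ sym (countFin-split P (isLower g)) ⟩
      countFin P
    ∎
    where
    open ≡-Reasoning
    lower→upper : ∀ z → P z ∧ isLower g z ≡ true → P (g z) ∧ not (isLower g (g z)) ≡ true
    lower→upper z h = ∧-true (P-resp z (∧-trueˡ (P z) h)) (cong not (¬-not λ lt →
      ℕP.<-asym (<ᵇ⇒< (∧-trueʳ (P z) h)) (subst (λ w → toℕ (g z) < toℕ w) (g-inv z) (<ᵇ⇒< lt))))
    upper→lower : ∀ z → P z ∧ not (isLower g z) ≡ true → P (g z) ∧ isLower g (g z) ≡ true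
    upper→lower z h = ∧-true (P-resp z (∧-trueˡ (P z) h)) (<⇒<ᵇ (subst (λ w → toℕ (g z) < toℕ w) (sym (g-inv z))
      (ℕP.≤∧≢⇒< (ℕP.≮⇒≥ (λ lt → not-¬ (<⇒<ᵇ lt) (not-true (∧-trueʳ (P z) h)))) (λ e → g-fpf z (toℕ-injective e)))))

  isEven : ℕ → Bool
  isEven zero    = true
  isEven (suc n) = not (isEven n)

  module AlternatingWalk {N : ℕ} (a b : Fin N → Fin N) (a-inv : ∀ z → a (a z) ≡ z) (b-inv : ∀ z → b (b z) ≡ z)
                         (a-fpf : ∀ z → a z ≢ z) (b-fpf : ∀ z → b z ≢ z) (x : Fin N) where

    step : ℕ → Fin N → Fin N
    step i = if isEven i then a else b

    walk : ℕ → Fin N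
    walk zero    = x
    walk (suc i) = step i (walk i)

    step-even : ∀ i → isEven i ≡ true → ∀ z → step i z ≡ a z
    step-even i e z rewrite e = refl

    step-odd : ∀ i → isEven i ≡ false → ∀ z → step i z ≡ b z
    step-odd i e z rewrite e = refl

    step-cong : ∀ i j → isEven i ≡ isEven j → ∀ z → step i z ≡ step j z
    step-cong i j e z rewrite e = refl

    step-inv : ∀ i z → step i (step i z) ≡ z
    step-inv i z with isEven i
    ... | true  = a-inv z
    ... | false = b-inv z

    step-fpf : ∀ i z → step i z ≢ z
    step-fpf i z with isEven i
    ... | true  = a-fpf z
    ... | false = b-fpf z

    step-back : ∀ i → step i (walk (suc i)) ≡ walk i
    step-back i = step-inv i (walk i)

    walk-orbit : ∀ i → x ∼[ a ∷ b ∷ [] ] walk i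
    walk-orbit zero    = ∼-refl (a ∷ b ∷ []) x
    walk-orbit (suc i) with isEven i
    ... | true  = ∼-trans (a ∷ b ∷ []) (walk-orbit i) (∼-gen (a ∷ b ∷ []) (here refl) (walk i))
    ... | false = ∼-trans (a ∷ b ∷ []) (walk-orbit i) (∼-gen (a ∷ b ∷ []) (there (here refl)) (walk i))

    Returns : ℕ → Set
    Returns j = Σ ℕ λ m → 1 ≤ m × m ≤ j × isEven m ≡ true × walk m ≡ x

    Returns-suc : ∀ {j} → Returns j → Returns (suc j)
    Returns-suc (m , 1≤m , m≤j , even , back) = m , 1≤m , ℕP.m≤n⇒m≤1+n m≤j , even , back

    -- A repetition walk i ≡ walk j can be pushed back, two steps at a time, until it becomes a return to x
    -- after an even number of steps; odd returns and adjacent repetitions would be fixed points.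
    returns : ∀ i j → i < j → walk i ≡ walk j → Returns j
    returns-from-ax : ∀ j → isEven j ≡ true → walk j ≡ a x → Returns (suc j)

    returns zero (suc j) _ x≡w with isEven (suc j) in e
    ... | true  = suc j , s≤s z≤n , ℕP.≤-refl , e , sym x≡w
    ... | false = returns-from-ax j j-even
                    (trans (sym (a-inv (walk j))) (cong a (sym (trans x≡w (step-even j j-even (walk j))))))
      where
      j-even : isEven j ≡ true
      j-even = not-injective {y = true} e
    returns (suc i) (suc j) (s≤s i<j) eq with isEven i ≟ᵇ isEven j
    ... | yes same = Returns-suc (returns i j i<j
            (trans (sym (step-inv j (walk i))) (trans (cong (step j) (trans (sym (step-cong i j same (walk i))) eq))
                                                      (step-inv j (walk j)))))
    ... | no differ with ℕP.<-cmp (suc (suc i)) j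
    ...   | tri< i+2<j _ _ = Returns-suc (returns (suc (suc i)) j i+2<j
            (trans (cong (step (suc i)) eq) (trans (step-cong (suc i) j parity (walk (suc j))) (step-back j))))
      where
      parity : isEven (suc i) ≡ isEven j
      parity = trans (cong not (¬-not differ)) (not-involutive (isEven j))
    ...   | tri≈ _ refl _ = ⊥-elim (differ (sym (not-involutive (isEven i))))
    ...   | tri> _ _ j<i+2 with ℕP.≤-antisym (ℕP.≤-pred j<i+2) i<j
    ...     | refl = ⊥-elim (step-fpf (suc i) (walk (suc i)) (sym eq))

    returns-from-ax zero          _ w = ⊥-elim (a-fpf x (sym w))
    returns-from-ax (suc zero)    () _
    returns-from-ax (suc (suc k)) _ w = Returns-suc (returns 1 (suc (suc k)) (s≤s (s≤s z≤n)) (sym w))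

    orbit⊆walk : ∀ m → 1 ≤ m → isEven m ≡ true → walk m ≡ x →
      ∀ {z} → x ∼[ a ∷ b ∷ [] ] z → z ∈ applyUpTo walk m
    orbit⊆walk (suc m) _ even back o = ∼-invariant (a ∷ b ∷ []) (_∈ W) (a-closed ∷ b-closed ∷ []) o (∈-applyUpTo⁺ walk (s≤s z≤n))
      where
      W : List (Fin N)
      W = applyUpTo walk (suc m)
      visited : ∀ {i} → i < suc m → walk i ∈ W
      visited = ∈-applyUpTo⁺ walk
      forward : ∀ i → i < suc m → walk (suc i) ∈ W
      forward i i<m with ℕP.m≤n⇒m<n∨m≡n i<m
      ... | inj₁ i+1<m = visited i+1<m
      ... | inj₂ refl  = subst (_∈ W) (sym back) (visited (s≤s z≤n))
      a-closed : ∀ z → z ∈ W → a z ∈ W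
      a-closed _ z∈W with ∈-applyUpTo⁻ walk z∈W
      ... | i , i<m , refl with isEven i in e
      ...   | true = subst (_∈ W) (step-even i e (walk i)) (forward i i<m)
      a-closed _ _ | zero  , _   , refl | false = ⊥-elim (not-¬ e refl)
      a-closed _ _ | suc i , i<m , refl | false =
        subst (_∈ W) (trans (sym (step-back i)) (step-even i (not-injective {y = true} e) (walk (suc i))))
          (visited (ℕP.<-trans (ℕP.n<1+n i) i<m))
      b-closed : ∀ z → z ∈ W → b z ∈ W
      b-closed _ z∈W with ∈-applyUpTo⁻ walk z∈W
      ... | i , i<m , refl with isEven i in e
      ...   | false = subst (_∈ W) (step-odd i e (walk i)) (forward i i<m)
      b-closed _ _ | zero  , _   , refl | true =
        subst (_∈ W) (trans (sym (step-back m)) (trans (cong (step m) back) (step-odd m (not-injective {y = false} even) x)))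
          (visited ℕP.≤-refl)
      b-closed _ _ | suc i , i<m , refl | true =
        subst (_∈ W) (trans (sym (step-back i)) (step-odd i (not-injective {y = false} e) (walk (suc i))))
          (visited (ℕP.<-trans (ℕP.n<1+n i) i<m))

    orbit-≤-return : ∀ m → 1 ≤ m → isEven m ≡ true → walk m ≡ x → countFin (sameOrbit (a ∷ b ∷ []) x) ≤ m
    orbit-≤-return m 1≤m even back = ℕP.≤-trans
      (countFin-mono (sameOrbit (a ∷ b ∷ []) x) (_∈ᵇ applyUpTo walk m) (λ z o → ∈ᵇ⁺ (orbit⊆walk m 1≤m even back o)))
      (ℕP.≤-trans (countFin-∈ᵇ-≤ (applyUpTo walk m)) (ℕP.≤-reflexive (length-applyUpTo walk m)))

    degree-4 : 8 ≤ countFin (sameOrbit (a ∷ b ∷ []) x) → countFin (sameOrbit (a ∷ b ∷ []) x) ≤ 9 →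
      walk 8 ≡ x × walk 4 ≢ x
    degree-4 8≤s s≤9 = returns-8 , λ back → ℕP.<⇒≱ (ℕP.m<n+m 4 {n = 4} (s≤s z≤n)) (ℕP.≤-trans 8≤s (orbit-≤-return 4 (s≤s z≤n) refl back))
      where
      eight : ∀ {m} → 8 ≤ m → m ≤ 9 → isEven m ≡ true → m ≡ 8
      eight 8≤m m≤9 even with ℕP.m≤n⇒m<n∨m≡n m≤9
      ... | inj₁ m<9 = ℕP.≤-antisym (ℕP.≤-pred m<9) 8≤m
      ... | inj₂ refl = ⊥-elim (not-¬ even refl)
      returns-8 : walk 8 ≡ x
      returns-8 with countFin-applyUpTo-or-repeat walk 10
      ... | inj₁ ten = ⊥-elim (ℕP.<-irrefl refl (ℕP.≤-trans (ℕP.≤-reflexive (sym ten))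
              (ℕP.≤-trans (countFin-mono (_∈ᵇ applyUpTo walk 10) (sameOrbit (a ∷ b ∷ []) x) visited-orbit) s≤9)))
        where
        visited-orbit : ∀ z → z ∈ᵇ applyUpTo walk 10 ≡ true → x ∼[ a ∷ b ∷ [] ] z
        visited-orbit z h with ∈-applyUpTo⁻ walk (∈ᵇ⁻ (applyUpTo walk 10) h)
        ... | i , _ , refl = walk-orbit i
      ... | inj₂ (i , j , i<j , j<10 , eq) with returns i j i<j eq
      ... | m , 1≤m , m≤j , even , back =
        subst (λ k → walk k ≡ x) (eight (ℕP.≤-trans 8≤s (orbit-≤-return m 1≤m even back)) (ℕP.≤-pred (ℕP.≤-trans (s≤s m≤j) j<10)) even) back

  -- Generalized maps and diagrams

  module MapFacts {n : ℕ} (G : GMap n) where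
    open GMap G

    vGens-inv : Involutions vGens
    vGens-inv = inv₁ ∷ inv₂ ∷ []

    V-isEquivalence : IsEquivalence (Holds (sameOrbit vGens))
    V-isEquivalence = ∼-isEquivalence vGens vGens-inv

    E-isEquivalence : IsEquivalence (Holds (sameOrbit eGens))
    E-isEquivalence = ∼-isEquivalence eGens (inv₀ ∷ inv₂ ∷ [])

    F-isEquivalence : IsEquivalence (Holds (sameOrbit fGens))
    F-isEquivalence = ∼-isEquivalence fGens (inv₀ ∷ inv₁ ∷ [])

    edge-size : ∀ x → countFin (λ z → sameOrbit eGens x z ∧ true) ≡ 4
    edge-size x = trans (countFin-cong _ (sameOrbit eGens x) (λ z → ∧-identityʳ _))
                        (orbit-size-4 θ₀ θ₂ inv₀ inv₂ comm₀₂ x (fpf₀ x) (fpf₂ x) (fpf₀₂ x) (fpf₀ (θ₂ x)))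

    flags≡4#E : n ≡ 4 * #E
    flags≡4#E = trans (sym (countFin-all (λ (_ : Fin n) → true) (λ _ → refl)))
      (Fibres.countFin-fibres-≡ (sameOrbit eGens) E-isEquivalence (λ _ → true) (λ _ _ → refl) (λ _ → true) 4
         (λ i _ _ → edge-size i))

  inv-move : ∀ {N} (f : Fin N → Fin N) → (∀ z → f (f z) ≡ z) → ∀ {p q} → f p ≡ q → p ≡ f q
  inv-move f f-inv {p} e = trans (sym (f-inv p)) (cong f e)

  4a≡4b+g⇒4≤g : ∀ a b g → 4 * a ≡ 4 * b + g → 1 ≤ g → 4 ≤ g
  4a≡4b+g⇒4≤g a b g e 1≤g with ℕP.≤-<-connex a b
  ... | inj₁ a≤b = ⊥-elim (ℕP.<-irrefl refl (ℕP.<-≤-trans (ℕP.m<m+n (4 * b) 1≤g)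
                     (ℕP.≤-trans (ℕP.≤-reflexive (sym e)) (ℕP.*-monoʳ-≤ 4 a≤b))))
  ... | inj₂ b<a = ℕP.+-cancelˡ-≤ (4 * b) 4 g (ℕP.≤-trans (ℕP.≤-reflexive (trans (ℕP.+-comm (4 * b) 4) (sym (ℕP.*-suc 4 b))))
                     (ℕP.≤-trans (ℕP.*-monoʳ-≤ 4 b<a) (ℕP.≤-reflexive e)))

  module DiagramFacts {n : ℕ} (D : Diagram n) where
    open Diagram D
    open MapFacts map

    cross-∼ᵥ : ∀ {x y} → x ∼[ vGens ] y → cross y ≡ cross x
    cross-∼ᵥ {x} o = ∼-invariant vGens (λ z → cross z ≡ cross x)
      ((λ z e → trans (cross-θ₁ z) e) ∷ (λ z e → trans (cross-θ₂ z) e) ∷ []) o refl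

    #V≡c+#VG : #V ≡ c + #VG
    #V≡c+#VG = trans (countFin-split (λ i → isRep vGens i ∧ true) cross)
      (cong₂ _+_ (countFin-cong _ _ (λ i → cong (_∧ cross i) (∧-identityʳ _)))
                 (countFin-cong _ _ (λ i → cong (_∧ not (cross i)) (∧-identityʳ _))))

    -- degree is ⌊orbit size / 2⌋, so a 4-valent crossing only bounds its orbit size by 8 and 9.
    crossing-size : ∀ x → cross x ≡ true → 8 ≤ orbitSize vGens x × orbitSize vGens x ≤ 9
    crossing-size x cx = subst (8 ≤_) (sym size≡) (ℕP.m≤n+m 8 (s % 2)) ,
                         subst (_≤ 9) (sym size≡) (ℕP.+-monoˡ-≤ 8 (ℕP.≤-pred (m%n<n s 2)))
      where
      s = orbitSize vGens x
      size≡ : s ≡ s % 2 + 8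
      size≡ = trans (m≡m%n+[m/n]*n s 2) (cong (λ q → s % 2 + q * 2) (cross-deg4 x cx))

    rotation : ∀ x → cross x ≡ true →
      θ₂ (θ₁ (θ₂ (θ₁ (θ₂ (θ₁ (θ₂ (θ₁ x))))))) ≡ x × θ₂ (θ₁ (θ₂ (θ₁ x))) ≢ x
    rotation x cx = AlternatingWalk.degree-4 θ₁ θ₂ inv₁ inv₂ fpf₁ fpf₂ x (proj₁ (crossing-size x cx)) (proj₂ (crossing-size x cx))

    pass-cross : ∀ x → cross x ≡ true → pass x ≡ θ₁ (θ₂ (θ₁ x))
    pass-cross x cx rewrite cx = refl

    pass-noncross : ∀ x → cross x ≡ false → pass x ≡ x
    pass-noncross x cx rewrite cx = refl

    cross-θ₁θ₂θ₁ : ∀ x → cross (θ₁ (θ₂ (θ₁ x))) ≡ cross x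
    cross-θ₁θ₂θ₁ x = trans (cross-θ₁ _) (trans (cross-θ₂ _) (cross-θ₁ x))

    cross-pass : ∀ x → cross (pass x) ≡ cross x
    cross-pass x with cross x in cx
    ... | true  = trans (cross-θ₁θ₂θ₁ x) cx
    ... | false = cx

    pass-inv : ∀ x → pass (pass x) ≡ x
    pass-inv x with cross x in cx
    ... | false = pass-noncross x cx
    ... | true rewrite pass-cross (θ₁ (θ₂ (θ₁ x))) (trans (cross-θ₁θ₂θ₁ x) cx) | inv₁ (θ₂ (θ₁ x)) | inv₂ (θ₁ x) = inv₁ x

    pass-fpf : ∀ x → cross x ≡ true → pass x ≢ x
    pass-fpf x cx e = fpf₂ (θ₁ x) (inv-move θ₁ inv₁ (trans (sym (pass-cross x cx)) e))

    θ₂-pass : ∀ z → θ₂ (pass z) ≡ pass (θ₂ z)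
    θ₂-pass z with cross z in cz
    ... | false = sym (pass-noncross (θ₂ z) (trans (cross-θ₂ z) cz))
    ... | true  = trans (inv-move θ₁ inv₁ (inv-move θ₂ inv₂ (inv-move θ₁ inv₁ (inv-move θ₂ inv₂ (proj₁ (rotation z cz))))))
                        (sym (pass-cross (θ₂ z) (trans (cross-θ₂ z) cz)))

    quadGens : List (Fin n → Fin n)
    quadGens = θ₂ ∷ pass ∷ []

    crossing-quad-size : ∀ x → cross x ≡ true → countFin (λ z → sameOrbit quadGens x z ∧ true) ≡ 4
    crossing-quad-size x cx = trans (countFin-cong _ (sameOrbit quadGens x) (λ z → ∧-identityʳ _))
      (orbit-size-4 θ₂ pass inv₂ pass-inv θ₂-pass x (fpf₂ x) (pass-fpf x cx)
         (subst (λ w → θ₂ w ≢ x) (sym (pass-cross x cx)) (proj₂ (rotation x cx))) (fpf₂ (pass x)))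

    S-isEquivalence : IsEquivalence (Holds (sameOrbit strandGens))
    S-isEquivalence = ∼-isEquivalence strandGens (inv₀ ∷ inv₂ ∷ pass-inv ∷ [])

    Q-isEquivalence : IsEquivalence (Holds (sameOrbit quadGens))
    Q-isEquivalence = ∼-isEquivalence quadGens (inv₂ ∷ pass-inv ∷ [])

    -- A strand is a union of edges (4 flags each), and its crossing flags form ⟨θ₂, pass⟩-orbits of 4 flags;
    -- so its flags at vertices of G, of which there is at least one, number a positive multiple of 4.
    strand-vertex-flags : ∀ s → 4 ≤ countFin (λ j → sameOrbit strandGens s j ∧ not (cross j))
    strand-vertex-flags s = 4a≡4b+g⇒4≤g (numClasses (sameOrbit eGens) inS) (numClasses (sameOrbit quadGens) (λ j → inS j ∧ cross j))
      (countFin (λ j → inS j ∧ not (cross j))) split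
      (countFin-pos (λ j → inS j ∧ not (cross j)) _ (proj₂ (anyFin⁻ (λ j → inS j ∧ not (cross j)) (strand-vertex s))))
      where
      module S = IsEquivalence S-isEquivalence
      inS : Fin n → Bool
      inS = sameOrbit strandGens s
      gen : ∀ {g} → g ∈ strandGens → ∀ x → x ∼[ strandGens ] g x
      gen = ∼-gen strandGens
      E⊆S : ∀ {x y} → x ∼[ eGens ] y → x ∼[ strandGens ] y
      E⊆S = ∼-map eGens strandGens (λ z → z) (gen (here refl) ∷ gen (there (here refl)) ∷ [])
      Q⊆S : ∀ {x y} → x ∼[ quadGens ] y → x ∼[ strandGens ] y
      Q⊆S = ∼-map quadGens strandGens (λ z → z) (gen (there (here refl)) ∷ gen (there (there (here refl))) ∷ [])
      cross-∼Q : ∀ {x y} → x ∼[ quadGens ] y → cross y ≡ cross x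
      cross-∼Q {x} o = ∼-invariant quadGens (λ z → cross z ≡ cross x)
        ((λ z e → trans (cross-θ₂ z) e) ∷ (λ z e → trans (cross-pass z) e) ∷ []) o refl
      flags : countFin (λ j → inS j ∧ true) ≡ 4 * numClasses (sameOrbit eGens) inS
      flags = Fibres.countFin-fibres-≡ (sameOrbit eGens) E-isEquivalence inS (λ o h → S.trans h (E⊆S o)) (λ _ → true)
                4 (λ i _ _ → edge-size i)
      crossingFlags : countFin (λ j → (inS j ∧ cross j) ∧ true) ≡ 4 * numClasses (sameOrbit quadGens) (λ j → inS j ∧ cross j)
      crossingFlags = Fibres.countFin-fibres-≡ (sameOrbit quadGens) Q-isEquivalence (λ j → inS j ∧ cross j)
        (λ {x} o h → ∧-true (S.trans (∧-trueˡ (inS x) h) (Q⊆S o)) (trans (cross-∼Q o) (∧-trueʳ (inS x) h)))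
        (λ _ → true) 4 (λ i _ h → crossing-quad-size i (∧-trueʳ (inS i) h))
      split : 4 * numClasses (sameOrbit eGens) inS ≡
              4 * numClasses (sameOrbit quadGens) (λ j → inS j ∧ cross j) + countFin (λ j → inS j ∧ not (cross j))
      split = trans (sym flags) (trans (countFin-cong _ inS (λ j → ∧-identityʳ _)) (trans (countFin-split inS cross)
                (cong (_+ countFin (λ j → inS j ∧ not (cross j)))
                      (trans (countFin-cong (λ j → inS j ∧ cross j) _ (λ j → sym (∧-identityʳ _))) crossingFlags))))

    #EG+2c≤#E : #EG + 2 * c ≤ #E
    #EG+2c≤#E = ℕP.*-cancelˡ-≤ 4 (begin
        4 * (#EG + 2 * c)
      ≡⟨ trans (ℕP.*-distribˡ-+ 4 #EG (2 * c)) (cong (4 * #EG +_) (sym (ℕP.*-assoc 4 2 c))) ⟩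
        4 * #EG + 8 * c
      ≤⟨ ℕP.+-mono-≤ strand-bound crossing-bound ⟩
        countFin (λ j → not (cross j)) + countFin (λ j → cross j ∧ true)
      ≡⟨ trans (ℕP.+-comm (countFin (λ j → not (cross j))) _)
               (cong (_+ countFin (λ j → not (cross j))) (countFin-cong _ cross (λ j → ∧-identityʳ _))) ⟩
        countFin cross + countFin (λ j → not (cross j))
      ≡⟨ trans (sym (countFin-split (λ _ → true) cross)) (countFin-all _ (λ _ → refl)) ⟩
        n
      ≡⟨ flags≡4#E ⟩
        4 * #E
      ∎)
      where
      open ℕP.≤-Reasoning
      strand-bound : 4 * #EG ≤ countFin (λ j → not (cross j))
      strand-bound = Fibres.countFin-fibres-≥ (sameOrbit strandGens) S-isEquivalence (λ _ → true) (λ _ _ → refl)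
        (λ j → not (cross j)) 4 (λ i _ _ → strand-vertex-flags i)
      crossing-bound : 8 * c ≤ countFin (λ j → cross j ∧ true)
      crossing-bound = Fibres.countFin-fibres-≥ (sameOrbit vGens) V-isEquivalence cross (λ o h → trans (cross-∼ᵥ o) h)
        (λ _ → true) 8 (λ i _ ci → subst (8 ≤_) (countFin-cong (sameOrbit vGens i) _ (λ j → sym (∧-identityʳ _)))
                                          (proj₁ (crossing-size i ci)))

  -- Smoothings

  -- Diagram.stepA and Diagram.stepB are smoothing D isA and smoothing D (not ∘ isA).
  smoothing : ∀ {n} → Diagram n → (Fin n → Bool) → Fin n → Fin n
  smoothing D d f = if Diagram.cross D f ∧ d f then f else Diagram.θ₁ D f

  smoothingGens : ∀ {n} → Diagram n → (Fin n → Bool) → List (Fin n → Fin n)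
  smoothingGens D d = Diagram.θ₀ D ∷ Diagram.θ₂ D ∷ smoothing D d ∷ []

  module _ {n : ℕ} (D : Diagram n) (d : Fin n → Bool) where
    open Diagram D

    smoothing-cut : ∀ f → cross f ∧ d f ≡ true → smoothing D d f ≡ f
    smoothing-cut f e rewrite e = refl

    smoothing-kept : ∀ f → cross f ∧ d f ≡ false → smoothing D d f ≡ θ₁ f
    smoothing-kept f e rewrite e = refl

    smoothing-kept-vertex : ∀ f → cross f ≡ false → smoothing D d f ≡ θ₁ f
    smoothing-kept-vertex f cf = smoothing-kept f (cong (_∧ d f) cf)

    vertex⊆smoothing : ∀ {x y} → x ∼[ vGens ] y → cross x ≡ false → x ∼[ smoothingGens D d ] y
    vertex⊆smoothing = ∼-elim vGens (λ x y → cross x ≡ false → x ∼[ smoothingGens D d ] y) (λ x _ → ∼-refl _ x)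
      ((λ x y r cx → ∼-trans (smoothingGens D d)
                       (subst (x ∼[ smoothingGens D d ]_) (smoothing-kept-vertex x cx) (∼-gen _ (there (there (here refl))) x))
                       (r (trans (cross-θ₁ x) cx))) ∷
       (λ x y r cx → ∼-trans (smoothingGens D d) (∼-gen _ (there (here refl)) x) (r (trans (cross-θ₂ x) cx))) ∷ [])

    module _ (d-θ₁ : ∀ f → cross f ≡ true → d (θ₁ f) ≡ d f) where

      cut-θ₁ : ∀ f → cross (θ₁ f) ∧ d (θ₁ f) ≡ cross f ∧ d f
      cut-θ₁ f with cross f in cf
      ... | true  rewrite cross-θ₁ f | cf = d-θ₁ f cf
      ... | false rewrite cross-θ₁ f | cf = refl

      smoothing-inv : ∀ f → smoothing D d (smoothing D d f) ≡ f
      smoothing-inv f with cross f ∧ d f in e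
      ... | true  = smoothing-cut f e
      ... | false = trans (smoothing-kept (θ₁ f) (trans (cut-θ₁ f) e)) (inv₁ f)

      smoothing-isEquivalence : IsEquivalence (Holds (sameOrbit (smoothingGens D d)))
      smoothing-isEquivalence = ∼-isEquivalence (smoothingGens D d) (inv₀ ∷ inv₂ ∷ smoothing-inv ∷ [])

  -- κ colours the faces (false = black) and d agrees with κ at crossings, so smoothing D d keeps exactly
  -- the black crossing corners.
  module SmoothingBound {n : ℕ} (D : Diagram n) (κ : Fin n → Bool)
    (κ-θ₀ : ∀ f → κ (Diagram.θ₀ D f) ≡ κ f) (κ-θ₁ : ∀ f → κ (Diagram.θ₁ D f) ≡ κ f)
    (κ-θ₂ : ∀ f → κ (Diagram.θ₂ D f) ≡ not (κ f))
    (d : Fin n → Bool) (d≡κ : ∀ f → Diagram.cross D f ≡ true → d f ≡ κ f) where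

    open Diagram D
    open MapFacts map
    open DiagramFacts D
    module V = IsEquivalence V-isEquivalence
    module RV = Classes (sameOrbit vGens) V-isEquivalence

    d-θ₁ : ∀ f → cross f ≡ true → d (θ₁ f) ≡ d f
    d-θ₁ f cf = trans (d≡κ (θ₁ f) (trans (cross-θ₁ f) cf)) (trans (κ-θ₁ f) (sym (d≡κ f cf)))

    Sm : List (Fin n → Fin n)
    Sm = smoothingGens D d

    -- Each ⟨θ₀, θ₂, cutWhite⟩-orbit is a black face together with the white flags across its edges.
    cutWhite : Fin n → Fin n
    cutWhite f = if κ f then f else θ₁ f

    cutWhite-white : ∀ f → κ f ≡ true → cutWhite f ≡ f
    cutWhite-white f e rewrite e = refl

    cutWhite-black : ∀ f → κ f ≡ false → cutWhite f ≡ θ₁ f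
    cutWhite-black f e rewrite e = refl

    cutWhite-inv : ∀ f → cutWhite (cutWhite f) ≡ f
    cutWhite-inv f with κ f in e
    ... | true  = cutWhite-white f e
    ... | false = trans (cutWhite-black (θ₁ f) (trans (κ-θ₁ f) e)) (inv₁ f)

    Bl : List (Fin n → Fin n)
    Bl = θ₀ ∷ θ₂ ∷ cutWhite ∷ []

    Bl-isEquivalence : IsEquivalence (Holds (sameOrbit Bl))
    Bl-isEquivalence = ∼-isEquivalence Bl (inv₀ ∷ inv₂ ∷ cutWhite-inv ∷ [])

    Bl-θ₁ : ∀ w → κ w ≡ false → w ∼[ Bl ] θ₁ w
    Bl-θ₁ w e = subst (w ∼[ Bl ]_) (cutWhite-black w e) (∼-gen Bl (there (there (here refl))) w)

    toBlack : Fin n → Fin n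
    toBlack f = if κ f then θ₂ f else f

    toBlack-black : ∀ f → κ (toBlack f) ≡ false
    toBlack-black f with κ f in e
    ... | true  = trans (κ-θ₂ f) (cong not e)
    ... | false = e

    toBlack-∼ᵥ : ∀ f → f ∼[ vGens ] toBlack f
    toBlack-∼ᵥ f with κ f
    ... | true  = ∼-gen vGens (there (here refl)) f
    ... | false = ∼-refl vGens f

    blackFaces≤regions : numOrbits fGens (λ f → not (κ f)) ≤ numOrbits Bl (λ _ → true)
    blackFaces≤regions = numClasses-surjection (sameOrbit Bl) (sameOrbit fGens) Bl-isEquivalence F-isEquivalence
      (λ _ → true) (λ f → not (κ f)) toBlack (λ _ → ∼-map Bl fGens toBlack (via-θ₀ ∷ via-θ₂ ∷ via-cut ∷ [])) (λ _ _ → refl)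
      (λ y hy → y , refl , subst (λ z → z ∼[ fGens ] y) (sym (toBlack-id y (not-true hy))) (∼-refl fGens y))
      where
      toBlack-id : ∀ f → κ f ≡ false → toBlack f ≡ f
      toBlack-id f e rewrite e = refl
      via-θ₀ : ∀ x → toBlack x ∼[ fGens ] toBlack (θ₀ x)
      via-θ₀ x with κ x in e
      ... | true  rewrite κ-θ₀ x | e = subst (θ₂ x ∼[ fGens ]_) (comm₀₂ x) (∼-gen fGens (here refl) (θ₂ x))
      ... | false rewrite κ-θ₀ x | e = ∼-gen fGens (here refl) x
      via-θ₂ : ∀ x → toBlack x ∼[ fGens ] toBlack (θ₂ x)
      via-θ₂ x with κ x in e
      ... | true  rewrite κ-θ₂ x | e = ∼-refl fGens (θ₂ x)
      ... | false rewrite κ-θ₂ x | e | inv₂ x = ∼-refl fGens x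
      via-cut : ∀ x → toBlack x ∼[ fGens ] toBlack (cutWhite x)
      via-cut x with κ x in e
      ... | true  rewrite e = ∼-refl fGens (θ₂ x)
      ... | false rewrite κ-θ₁ x | e = ∼-gen fGens (there (here refl)) x

    -- Each vertex of G gets a hub, a black flag there; the other black corners at vertices of G, each
    -- represented by its lower flag, are bridges to the hub.  They are what the smoothing adds to Bl.
    hubOf : Fin n → Fin n
    hubOf x = toBlack (RV.rep x)

    lowerFlag : Fin n → Fin n
    lowerFlag z = if isLower θ₁ z then z else θ₁ z

    vertexCorner : Fin n → Bool
    vertexCorner z = (not (cross z) ∧ not (κ z)) ∧ isLower θ₁ z

    isBridge : Fin n → Bool
    isBridge z = vertexCorner z ∧ not ⌊ z ≟ lowerFlag (hubOf z) ⌋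

    hub-∼ᵥ : ∀ x → x ∼[ vGens ] hubOf x
    hub-∼ᵥ x = V.trans (V.sym (RV.rep-rel x)) (toBlack-∼ᵥ (RV.rep x))

    lowerFlag-cases : ∀ z → lowerFlag z ≡ z ⊎ lowerFlag z ≡ θ₁ z
    lowerFlag-cases z with isLower θ₁ z
    ... | true  = inj₁ refl
    ... | false = inj₂ refl

    lowerFlag-isLower : ∀ z → isLower θ₁ (lowerFlag z) ≡ true
    lowerFlag-isLower z with isLower θ₁ z in e
    ... | true  = e
    ... | false rewrite inv₁ z =
      <⇒<ᵇ (ℕP.≤∧≢⇒< (ℕP.≮⇒≥ (λ lt → not-¬ (<⇒<ᵇ lt) e)) (λ q → fpf₁ z (toℕ-injective q)))

    Bl-lowerFlag : ∀ w → κ w ≡ false → w ∼[ Bl ] lowerFlag w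
    Bl-lowerFlag w e with lowerFlag-cases w
    ... | inj₁ q = subst (w ∼[ Bl ]_) (sym q) (∼-refl Bl w)
    ... | inj₂ q = subst (w ∼[ Bl ]_) (sym q) (Bl-θ₁ w e)

    κ-lowerFlag : ∀ w → κ (lowerFlag w) ≡ κ w
    κ-lowerFlag w with lowerFlag-cases w
    ... | inj₁ q = cong κ q
    ... | inj₂ q = trans (cong κ q) (κ-θ₁ w)

    lowerFlag-∼ᵥ : ∀ w → w ∼[ vGens ] lowerFlag w
    lowerFlag-∼ᵥ w with lowerFlag-cases w
    ... | inj₁ q = subst (w ∼[ vGens ]_) (sym q) (∼-refl vGens w)
    ... | inj₂ q = subst (w ∼[ vGens ]_) (sym q) (∼-gen vGens (here refl) w)

    open Merging (sameOrbit Bl) (sameOrbit Sm) Bl-isEquivalence (smoothing-isEquivalence D d d-θ₁) hubOf isBridge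

    smoothing-black : ∀ x → κ x ≡ false → smoothing D d x ≡ θ₁ x
    smoothing-black x kx = smoothing-kept D d x kept
      where
      kept : cross x ∧ d x ≡ false
      kept with cross x in cx
      ... | true  = trans (d≡κ x cx) kx
      ... | false = refl

    Bl⊆Sm : ∀ {x y} → x ∼[ Bl ] y → x ∼[ Sm ] y
    Bl⊆Sm = ∼-map Bl Sm (λ z → z) (∼-gen Sm (here refl) ∷ ∼-gen Sm (there (here refl)) ∷ cut ∷ [])
      where
      cut : ∀ x → x ∼[ Sm ] cutWhite x
      cut x with κ x in e
      ... | true  = ∼-refl Sm x
      ... | false = subst (x ∼[ Sm ]_) (smoothing-black x e) (∼-gen Sm (there (there (here refl))) x)

    bridge⊆Sm : ∀ z → isBridge z ≡ true → z ∼[ Sm ] hubOf z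
    bridge⊆Sm z b = vertex⊆smoothing D d (hub-∼ᵥ z) (not-true (∧-trueˡ _ (∧-trueˡ _ (∧-trueˡ _ b))))

    -- Either the corner of w is the hub's, or it is a bridge.
    hub-linked : ∀ w → cross w ≡ false → κ w ≡ false → Linked w (hubOf w) × Linked (hubOf w) w
    hub-linked w cw kw with ⌊ lowerFlag w ≟ lowerFlag (hubOf (lowerFlag w)) ⌋ in e
    ... | true  = subst (λ h → Linked w h × Linked h w) same-hub
        ( Linked-trans (Linked-B (Bl-lowerFlag w kw))
            (subst (λ z → Linked z (hubOf ℓ)) (sym ℓ≡) (Linked-B (Bl.sym (Bl-lowerFlag _ (toBlack-black _)))))
        , Linked-trans (subst (Linked (hubOf ℓ)) (sym ℓ≡) (Linked-B (Bl-lowerFlag _ (toBlack-black _))))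
            (Linked-B (Bl.sym (Bl-lowerFlag w kw))) )
      where
      module Bl = IsEquivalence Bl-isEquivalence
      ℓ = lowerFlag w
      ℓ≡ : ℓ ≡ lowerFlag (hubOf ℓ)
      ℓ≡ = ≟-sound e
      same-hub : hubOf ℓ ≡ hubOf w
      same-hub = cong toBlack (RV.rep-cong (V.sym (lowerFlag-∼ᵥ w)))
    ... | false = subst (λ h → Linked w h × Linked h w) same-hub
        ( Linked-trans (Linked-B (Bl-lowerFlag w kw)) (Linked-out bridge)
        , Linked-trans (Linked-in bridge) (Linked-B (IsEquivalence.sym Bl-isEquivalence (Bl-lowerFlag w kw))) )
      where
      ℓ = lowerFlag w
      same-hub : hubOf ℓ ≡ hubOf w
      same-hub = cong toBlack (RV.rep-cong (V.sym (lowerFlag-∼ᵥ w)))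
      bridge : isBridge ℓ ≡ true
      bridge = ∧-true (∧-true (∧-true (cong not (trans (cross-∼ᵥ (lowerFlag-∼ᵥ w)) cw)) (cong not (trans (κ-lowerFlag w) kw)))
                              (lowerFlag-isLower w))
                      (cong not e)

    Sm⊆Linked : ∀ {x y} → x ∼[ Sm ] y → Linked x y
    Sm⊆Linked = ∼-elim Sm Linked (λ x → Linked-B (∼-refl Bl x))
      ((λ x y l → Linked-trans (Linked-B (∼-gen Bl (here refl) x)) l) ∷
       (λ x y l → Linked-trans (Linked-B (∼-gen Bl (there (here refl)) x)) l) ∷
       (λ x y l → Linked-trans (smoothing-linked x (cross x) (κ x) refl refl) l) ∷ [])
      where
      smoothing-linked : ∀ x c k → cross x ≡ c → κ x ≡ k → Linked x (smoothing D d x)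
      smoothing-linked x c false _ kx =
        subst (Linked x) (trans (cutWhite-black x kx) (sym (smoothing-black x kx))) (Linked-B (∼-gen Bl (there (there (here refl))) x))
      smoothing-linked x true true cx kx =
        subst (Linked x) (sym (smoothing-cut D d x (trans (cong (_∧ d x) cx) (trans (d≡κ x cx) kx)))) (Linked-B (∼-refl Bl x))
      smoothing-linked x false true cx kx = subst (Linked x) (sym (smoothing-kept-vertex D d x cx))
        (Linked-trans (Linked-B (∼-gen Bl (there (here refl)) x))
        (Linked-trans (proj₁ (hub-linked (θ₂ x) c₂ k₂))
        (Linked-trans (subst (λ h → Linked h (θ₂ (θ₁ x))) (sym same-hub) (proj₂ (hub-linked (θ₂ (θ₁ x)) c₂₁ k₂₁)))
                      (Linked-B (subst (θ₂ (θ₁ x) ∼[ Bl ]_) (inv₂ (θ₁ x)) (∼-gen Bl (there (here refl)) (θ₂ (θ₁ x))))))))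
        where
        c₂ : cross (θ₂ x) ≡ false
        c₂ = trans (cross-θ₂ x) cx
        k₂ : κ (θ₂ x) ≡ false
        k₂ = trans (κ-θ₂ x) (cong not kx)
        c₂₁ : cross (θ₂ (θ₁ x)) ≡ false
        c₂₁ = trans (cross-θ₂ _) (trans (cross-θ₁ x) cx)
        k₂₁ : κ (θ₂ (θ₁ x)) ≡ false
        k₂₁ = trans (κ-θ₂ _) (cong not (trans (κ-θ₁ x) kx))
        same-hub : hubOf (θ₂ x) ≡ hubOf (θ₂ (θ₁ x))
        same-hub = cong toBlack (RV.rep-cong
          (V.trans (V.sym (∼-gen vGens (there (here refl)) x))
            (V.trans (∼-gen vGens (here refl) x) (∼-gen vGens (there (here refl)) (θ₁ x)))))

    regions≤components+bridges : numOrbits Bl (λ _ → true) ≤ numOrbits Sm (λ _ → true) + countFin isBridge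
    regions≤components+bridges = numClasses-merge Bl⊆Sm bridge⊆Sm Sm⊆Linked

    blackCorner : Fin n → Bool
    blackCorner z = not (κ z) ∧ isLower θ₁ z

    #black≡#white : countFin (λ z → not (κ z)) ≡ countFin κ
    #black≡#white = countFin-involution θ₂ inv₂ _ _ (λ z h → trans (κ-θ₂ z) h)
      (λ z h → trans (cong not (κ-θ₂ z)) (trans (not-involutive (κ z)) h))

    #blackCorners≡#E : countFin blackCorner ≡ #E
    #blackCorners≡#E = ℕP.*-cancelˡ-≡ _ _ 2 (ℕP.*-cancelˡ-≡ _ _ 2 (begin
        2 * (2 * countFin blackCorner)
      ≡⟨ cong (2 *_) (countFin-half θ₁ inv₁ fpf₁ (λ z → not (κ z)) (λ z h → trans (cong not (κ-θ₁ z)) h)) ⟩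
        countFin (λ z → not (κ z)) + (countFin (λ z → not (κ z)) + 0)
      ≡⟨ cong (countFin (λ z → not (κ z)) +_) (trans (ℕP.+-identityʳ _) #black≡#white) ⟩
        countFin (λ z → not (κ z)) + countFin κ
      ≡⟨ trans (ℕP.+-comm _ (countFin κ)) (sym (countFin-split (λ _ → true) κ)) ⟩
        countFin (λ (_ : Fin n) → true)
      ≡⟨ trans (countFin-all _ (λ _ → refl)) flags≡4#E ⟩
        4 * #E
      ≡⟨ ℕP.*-assoc 2 2 #E ⟩
        2 * (2 * #E)
      ∎))
      where open ≡-Reasoning

    crossingCorner : Fin n → Bool
    crossingCorner z = (cross z ∧ not (κ z)) ∧ isLower θ₁ z

    2c≤crossingCorners : 2 * c ≤ countFin crossingCorner
    2c≤crossingCorners = ℕP.*-cancelˡ-≤ 2 (ℕP.*-cancelˡ-≤ 2 (begin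
        2 * (2 * (2 * c))
      ≡⟨ sym (trans (ℕP.*-assoc 2 4 c) (cong (2 *_) (ℕP.*-assoc 2 2 c))) ⟩
        8 * c
      ≤⟨ Fibres.countFin-fibres-≥ (sameOrbit vGens) V-isEquivalence cross (λ o h → trans (cross-∼ᵥ o) h)
           (λ _ → true) 8 (λ i _ ci → subst (8 ≤_) (countFin-cong (sameOrbit vGens i) _ (λ j → sym (∧-identityʳ _)))
                                            (proj₁ (crossing-size i ci))) ⟩
        countFin (λ j → cross j ∧ true)
      ≡⟨ trans (countFin-cong _ cross (λ j → ∧-identityʳ _)) (countFin-split cross κ) ⟩
        countFin (λ z → cross z ∧ κ z) + countFin blackCrossing
      ≡⟨ cong₂ _+_ (sym whiteCrossing≡blackCrossing) (sym (ℕP.+-identityʳ _)) ⟩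
        2 * countFin blackCrossing
      ≡⟨ cong (2 *_) (sym (countFin-half θ₁ inv₁ fpf₁ blackCrossing
                            (λ z h → trans (cong₂ _∧_ (cross-θ₁ z) (cong not (κ-θ₁ z))) h))) ⟩
        2 * (2 * countFin crossingCorner)
      ∎))
      where
      open ℕP.≤-Reasoning
      blackCrossing : Fin n → Bool
      blackCrossing z = cross z ∧ not (κ z)
      whiteCrossing≡blackCrossing : countFin blackCrossing ≡ countFin (λ z → cross z ∧ κ z)
      whiteCrossing≡blackCrossing = countFin-involution θ₂ inv₂ _ _
        (λ z h → ∧-true (trans (cross-θ₂ z) (∧-trueˡ (cross z) h)) (trans (κ-θ₂ z) (∧-trueʳ (cross z) h)))
        (λ z h → ∧-true (trans (cross-θ₂ z) (∧-trueˡ (cross z) h))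
                        (trans (cong not (κ-θ₂ z)) (trans (not-involutive (κ z)) (∧-trueʳ (cross z) h))))

    hubCorner : Fin n → Bool
    hubCorner z = vertexCorner z ∧ ⌊ z ≟ lowerFlag (hubOf z) ⌋

    #VG≤hubCorners : #VG ≤ countFin hubCorner
    #VG≤hubCorners = countFin-injection _ hubCorner (λ r _ → lowerFlag (toBlack r)) into injective
      where
      near : ∀ r → r ∼[ vGens ] lowerFlag (toBlack r)
      near r = V.trans (toBlack-∼ᵥ r) (lowerFlag-∼ᵥ (toBlack r))
      into : ∀ r → isRep vGens r ∧ not (cross r) ≡ true → hubCorner (lowerFlag (toBlack r)) ≡ true
      into r hr = ∧-true (∧-true (∧-true (cong not (trans (cross-∼ᵥ (near r)) (not-true (∧-trueʳ (isRep vGens r) hr))))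
                                         (cong not (trans (κ-lowerFlag (toBlack r)) (toBlack-black r))))
                                 (lowerFlag-isLower (toBlack r)))
                         (subst (λ w → ⌊ lowerFlag (toBlack r) ≟ lowerFlag (toBlack w) ⌋ ≡ true) (sym rep≡r) (≟-refl _))
        where
        rep≡r : RV.rep (lowerFlag (toBlack r)) ≡ r
        rep≡r = trans (sym (RV.rep-cong (near r))) (RV.rep-idem (∧-trueˡ _ hr))
      injective : ∀ r₁ r₂ h₁ h₂ → lowerFlag (toBlack r₁) ≡ lowerFlag (toBlack r₂) → r₁ ≡ r₂
      injective r₁ r₂ h₁ h₂ e = RV.rep-unique (∧-trueˡ _ h₁) (∧-trueˡ _ h₂)
        (V.trans (near r₁) (V.sym (subst (r₂ ∼[ vGens ]_) (sym e) (near r₂))))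

    bridges+#VG+2c≤#E : countFin isBridge + #VG + 2 * c ≤ #E
    bridges+#VG+2c≤#E = begin
        countFin isBridge + #VG + 2 * c
      ≤⟨ ℕP.+-mono-≤ (ℕP.+-monoʳ-≤ (countFin isBridge) #VG≤hubCorners) 2c≤crossingCorners ⟩
        countFin isBridge + countFin hubCorner + countFin crossingCorner
      ≡⟨ cong (_+ countFin crossingCorner)
              (trans (ℕP.+-comm (countFin isBridge) _) (sym (countFin-split vertexCorner (λ z → ⌊ z ≟ lowerFlag (hubOf z) ⌋)))) ⟩
        countFin vertexCorner + countFin crossingCorner
      ≡⟨ ℕP.+-comm (countFin vertexCorner) _ ⟩
        countFin crossingCorner + countFin vertexCorner
      ≡⟨ sym (trans (countFin-split blackCorner cross) (cong₂ _+_ (countFin-cong _ _ (λ z → rotate _ _ (cross z)))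
                                                                  (countFin-cong _ _ (λ z → rotate _ _ (not (cross z)))))) ⟩
        countFin blackCorner
      ≡⟨ #blackCorners≡#E ⟩
        #E
      ∎
      where
      open ℕP.≤-Reasoning
      rotate : ∀ x y w → (x ∧ y) ∧ w ≡ (w ∧ x) ∧ y
      rotate x y w = trans (∧-comm (x ∧ y) w) (sym (∧-assoc w x y))

    faces-bound : numOrbits fGens (λ f → not (κ f)) + #VG + 2 * c ≤ numOrbits Sm (λ _ → true) + #E
    faces-bound = begin
        numOrbits fGens (λ f → not (κ f)) + #VG + 2 * c
      ≤⟨ ℕP.+-monoˡ-≤ (2 * c) (ℕP.+-monoˡ-≤ #VG (ℕP.≤-trans blackFaces≤regions regions≤components+bridges)) ⟩
        numOrbits Sm (λ _ → true) + countFin isBridge + #VG + 2 * c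
      ≡⟨ trans (cong (_+ 2 * c) (ℕP.+-assoc (numOrbits Sm (λ _ → true)) _ _)) (ℕP.+-assoc (numOrbits Sm (λ _ → true)) _ _) ⟩
        numOrbits Sm (λ _ → true) + (countFin isBridge + #VG + 2 * c)
      ≤⟨ ℕP.+-monoʳ-≤ (numOrbits Sm (λ _ → true)) bridges+#VG+2c≤#E ⟩
        numOrbits Sm (λ _ → true) + #E
      ∎
      where open ℕP.≤-Reasoning

  -- Adding edges inside faces

  module AddingEdges {n m k : ℕ} (D : Diagram n) (D' : Diagram (n + m)) (adds : AddsEdges D D' k) where
    private
      module D  = Diagram D
      module D' = Diagram D'
    open AddsEdges adds

    ι : Fin n → Fin (n + m)
    ι f = f ↑ˡ m

    ι-injective : ∀ {f f'} → ι f ≡ ι f' → f ≡ f'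
    ι-injective {f} {f'} e = toℕ-injective (trans (sym (toℕ-↑ˡ f m)) (trans (cong toℕ e) (toℕ-↑ˡ f' m)))

    old-or-new : ∀ g → (Σ (Fin n) λ f → g ≡ ι f) ⊎ (Σ (Fin m) λ j → g ≡ n ↑ʳ j)
    old-or-new g with splitAt n g | join-splitAt n m g
    ... | inj₁ f | e = inj₁ (f , sym e)
    ... | inj₂ j | e = inj₂ (j , sym e)

    isOld-ι : ∀ f → isOld D D' (ι f) ≡ true
    isOld-ι f = <⇒<ᵇ (subst (_< n) (sym (toℕ-↑ˡ f m)) (toℕ<n f))

    skipNew-old : ∀ K g → isOld D D' g ≡ true → skipNew D D' K g ≡ g
    skipNew-old zero    g _ = refl
    skipNew-old (suc K) g e rewrite e = refl

    crossing-old : ∀ g → D'.cross g ≡ true → Σ (Fin n) λ f → g ≡ ι f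
    crossing-old g cg with old-or-new g
    ... | inj₁ old            = old
    ... | inj₂ (j , refl) = ⊥-elim (not-¬ cg (cross-new j))

    θ₁-crossing : ∀ f → D.cross f ≡ true → D'.θ₁ (ι f) ≡ ι (D.θ₁ f)
    θ₁-crossing f cf with crossing-old (D'.θ₁ (ι f)) (trans (D'.cross-θ₁ (ι f)) (trans (cross-old f) cf))
    ... | f' , e = trans (sym (skipNew-old (n + m) _ (subst (λ z → isOld D D' z ≡ true) (sym e) (isOld-ι f')))) (θ₁-del f)

    c≤c' : D.c ≤ D'.c
    c≤c' = countFin-injection _ _ (λ r _ → RV'.rep (ι r))
      (λ r hr → ∧-true (RV'.rep-isClassRep (ι r))
         (trans (DiagramFacts.cross-∼ᵥ D' (V'.sym (RV'.rep-rel (ι r)))) (trans (cross-old r) (∧-trueʳ (isRep D.vGens r) hr))))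
      (λ r₁ r₂ h₁ h₂ e → RV.rep-unique (∧-trueˡ _ h₁) (∧-trueˡ _ h₂) (back r₁ (∧-trueʳ (isRep D.vGens r₁) h₁) (RV'.rep-injective e)))
      where
      module RV  = Classes (sameOrbit D.vGens) (MapFacts.V-isEquivalence D.map)
      module RV' = Classes (sameOrbit D'.vGens) (MapFacts.V-isEquivalence D'.map)
      module V'  = IsEquivalence (MapFacts.V-isEquivalence D'.map)
      OldCrossing : Fin n → Fin (n + m) → Set
      OldCrossing r g = Σ (Fin n) λ f → g ≡ ι f × r ∼[ D.vGens ] f × D.cross f ≡ true
      back : ∀ r₁ {r₂} → D.cross r₁ ≡ true → ι r₁ ∼[ D'.vGens ] ι r₂ → r₁ ∼[ D.vGens ] r₂
      back r₁ {r₂} cr o with ∼-invariant D'.vGens (OldCrossing r₁)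
          ((λ g (f , e , vf , cf) → D.θ₁ f , trans (cong D'.θ₁ e) (θ₁-crossing f cf) ,
               ∼-trans D.vGens vf (∼-gen D.vGens (here refl) f) , trans (D.cross-θ₁ f) cf) ∷
           (λ g (f , e , vf , cf) → D.θ₂ f , trans (cong D'.θ₂ e) (θ₂-old f) ,
               ∼-trans D.vGens vf (∼-gen D.vGens (there (here refl)) f) , trans (D.cross-θ₂ f) cf) ∷ [])
          o (r₁ , refl , ∼-refl D.vGens r₁ , cr)
      ... | f , e , vf , _ = subst (r₁ ∼[ D.vGens ]_) (sym (ι-injective e)) vf

    -- The new edges end at vertices of G, where every corner is kept, so they only add connections.
    module _ (d : Fin n → Bool) (d' : Fin (n + m) → Bool) (d'-ι : ∀ f → d' (ι f) ≡ d f)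
             (d-θ₁ : ∀ f → D.cross f ≡ true → d (D.θ₁ f) ≡ d f)
             (d'-θ₁ : ∀ f → D'.cross f ≡ true → d' (D'.θ₁ f) ≡ d' f) where

      private
        Sm : List (Fin n → Fin n)
        Sm = smoothingGens D d
        Sm' : List (Fin (n + m) → Fin (n + m))
        Sm' = smoothingGens D' d'

      skipNew-∼ : ∀ K g → D'.cross g ≡ false → g ∼[ Sm' ] skipNew D D' K g
      skipNew-∼ zero    g _  = ∼-refl Sm' g
      skipNew-∼ (suc K) g cg with isOld D D' g
      ... | true  = ∼-refl Sm' g
      ... | false = ∼-trans Sm' (∼-gen Sm' (there (here refl)) g)
          (∼-trans Sm' (subst (D'.θ₂ g ∼[ Sm' ]_) (smoothing-kept-vertex D' d' (D'.θ₂ g) c₂)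
                              (∼-gen Sm' (there (there (here refl))) (D'.θ₂ g)))
                       (skipNew-∼ K (D'.θ₁ (D'.θ₂ g)) (trans (D'.cross-θ₁ _) c₂)))
        where
        c₂ : D'.cross (D'.θ₂ g) ≡ false
        c₂ = trans (D'.cross-θ₂ g) cg

      ι-smoothing : ∀ x → ι x ∼[ Sm' ] ι (smoothing D d x)
      ι-smoothing x with D.cross x in cx | d x in dx
      ... | true | true = ∼-refl Sm' (ι x)
      ... | true | false = subst (ι x ∼[ Sm' ]_) (trans (smoothing-kept D' d' (ι x) ι-kept) (θ₁-crossing x cx))
                                 (∼-gen Sm' (there (there (here refl))) (ι x))
        where
        ι-kept : D'.cross (ι x) ∧ d' (ι x) ≡ false
        ι-kept rewrite cross-old x | d'-ι x | cx | dx = refl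
      ... | false | _ = ∼-trans Sm'
          (subst (ι x ∼[ Sm' ]_) (smoothing-kept-vertex D' d' (ι x) (trans (cross-old x) cx))
                 (∼-gen Sm' (there (there (here refl))) (ι x)))
          (subst (D'.θ₁ (ι x) ∼[ Sm' ]_) (θ₁-del x)
                 (skipNew-∼ (n + m) (D'.θ₁ (ι x)) (trans (D'.cross-θ₁ _) (trans (cross-old x) cx))))

      ι-∼ : ∀ {x y} → x ∼[ Sm ] y → ι x ∼[ Sm' ] ι y
      ι-∼ = ∼-map Sm Sm' ι
        ((λ x → subst (ι x ∼[ Sm' ]_) (θ₀-old x) (∼-gen Sm' (here refl) (ι x))) ∷
         (λ x → subst (ι x ∼[ Sm' ]_) (θ₂-old x) (∼-gen Sm' (there (here refl)) (ι x))) ∷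
         ι-smoothing ∷ [])

      components-≤ : numOrbits Sm' (λ _ → true) ≤ numOrbits Sm (λ _ → true)
      components-≤ = numClasses-surjection (sameOrbit Sm) (sameOrbit Sm')
        (smoothing-isEquivalence D d d-θ₁) (smoothing-isEquivalence D' d' d'-θ₁)
        (λ _ → true) (λ _ → true) ι (λ _ → ι-∼) (λ _ _ → refl) onto
        where
        onto : ∀ y → true ≡ true → Σ (Fin n) λ x → true ≡ true × ι x ∼[ Sm' ] y
        onto y _ with old-or-new y
        ... | inj₁ (f , e) = f , refl , subst (ι f ∼[ Sm' ]_) (sym e) (∼-refl Sm' (ι f))
        ... | inj₂ (j , e) with anyFin⁻ (λ f → sameOrbit D'.vGens (n ↑ʳ j) (f ↑ˡ m)) (new-at-old j)
        ... | f , hf = f , refl , subst (ι f ∼[ Sm' ]_) (sym e)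
            (IsEquivalence.sym (smoothing-isEquivalence D' d' d'-θ₁) (vertex⊆smoothing D' d' hf (cross-new j)))

  colour-bound : ∀ {n m k} (D : Diagram n) (D' : Diagram (n + m)) → AddsEdges D D' k →
    (κ : Fin (n + m) → Bool) → (∀ f → κ (Diagram.θ₀ D' f) ≡ κ f) → (∀ f → κ (Diagram.θ₁ D' f) ≡ κ f) →
    (∀ f → κ (Diagram.θ₂ D' f) ≡ not (κ f)) →
    (d : Fin n → Bool) (d' : Fin (n + m) → Bool) → (∀ f → d' (f ↑ˡ m) ≡ d f) →
    (∀ f → Diagram.cross D f ≡ true → d (Diagram.θ₁ D f) ≡ d f) → (∀ f → Diagram.cross D' f ≡ true → d' f ≡ κ f) →
    numOrbits (Diagram.fGens D') (λ f → not (κ f)) + Diagram.#VG D' + 2 * Diagram.c D'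
      ≤ numOrbits (smoothingGens D d) (λ _ → true) + (Diagram.#E D + k)
  colour-bound D D' adds κ κ-θ₀ κ-θ₁ κ-θ₂ d d' d'-ι d-θ₁ d'≡κ =
    subst (λ e → faces + Diagram.#VG D' + 2 * Diagram.c D' ≤ components + e) (AddsEdges.edges adds)
      (ℕP.≤-trans faces-bound (ℕP.+-monoˡ-≤ (Diagram.#E D') (AddingEdges.components-≤ D D' adds d d' d'-ι d-θ₁ d-θ₁')))
    where
    open SmoothingBound D' κ κ-θ₀ κ-θ₁ κ-θ₂ d' d'≡κ renaming (d-θ₁ to d-θ₁')
    faces components : ℕ
    faces = numOrbits (Diagram.fGens D') (λ f → not (κ f))
    components = numOrbits (smoothingGens D d) (λ _ → true)

  sum-of-colour-bounds : ∀ (c VG EG E F k cA cB c' VG' Fb Fw : ℕ) →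
    c' + VG' ≡ c + VG → F + k ≡ Fb + Fw → c ≤ c' → EG + 2 * c ≤ E →
    Fb + VG' + 2 * c' ≤ cA + (E + k) → Fw + VG' + 2 * c' ≤ cB + (E + k) →
    6 * c + EG + 2 * VG + F ≤ 3 * E + cA + cB + k
  sum-of-colour-bounds c VG EG E F k cA cB c' VG' Fb Fw vertices faces c≤c' strands boundA boundB =
    ℕP.+-cancelʳ-≤ (2 * c' + k) _ _ (begin
        6 * c + EG + 2 * VG + F + (2 * c' + k)
      ≡⟨ regroup₁ c VG EG F k c' ⟩
        (F + k) + 2 * (c + VG) + (2 * c' + 4 * c + EG)
      ≡⟨ cong₂ (λ u v → u + 2 * v + (2 * c' + 4 * c + EG)) faces (sym vertices) ⟩
        (Fb + Fw) + 2 * (c' + VG') + (2 * c' + 4 * c + EG)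
      ≡⟨ regroup₂ Fb Fw c' VG' c EG ⟩
        (Fb + VG' + 2 * c') + (Fw + VG' + 2 * c') + (2 * c + (EG + 2 * c))
      ≤⟨ ℕP.+-mono-≤ (ℕP.+-mono-≤ boundA boundB) (ℕP.+-mono-≤ (ℕP.*-monoʳ-≤ 2 c≤c') strands) ⟩
        (cA + (E + k)) + (cB + (E + k)) + (2 * c' + E)
      ≡⟨ regroup₃ cA cB E k c' ⟩
        3 * E + cA + cB + k + (2 * c' + k)
      ∎)
    where
    open ℕP.≤-Reasoning
    regroup₁ : ∀ c VG EG F k c' → 6 * c + EG + 2 * VG + F + (2 * c' + k) ≡ (F + k) + 2 * (c + VG) + (2 * c' + 4 * c + EG)
    regroup₁ = solve-∀
    regroup₂ : ∀ Fb Fw c' VG' c EG → (Fb + Fw) + 2 * (c' + VG') + (2 * c' + 4 * c + EG) ≡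
                                     (Fb + VG' + 2 * c') + (Fw + VG' + 2 * c') + (2 * c + (EG + 2 * c))
    regroup₂ = solve-∀
    regroup₃ : ∀ cA cB E k c' → (cA + (E + k)) + (cB + (E + k)) + (2 * c' + E) ≡ 3 * E + cA + cB + k + (2 * c' + k)
    regroup₃ = solve-∀

  β₁-sum-bound-ℤ : ∀ (c VG EG k E F cA cB : ℤ) →
    ℤ.+ 6 ℤ.* c ℤ.+ EG ℤ.+ ℤ.+ 2 ℤ.* VG ℤ.+ F ℤ.≤ ℤ.+ 3 ℤ.* E ℤ.+ cA ℤ.+ cB ℤ.+ k →
    ((c - (VG - EG)) - k) ℤ.+ (((c ℤ.+ VG) - E) ℤ.+ F) ℤ.≤
    ((ℤ.+ 2 ℤ.* E - (VG ℤ.+ E ℤ.+ ℤ.+ 2 ℤ.* c)) ℤ.+ cA) ℤ.+ ((ℤ.+ 2 ℤ.* E - (VG ℤ.+ E ℤ.+ ℤ.+ 2 ℤ.* c)) ℤ.+ cB)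
  β₁-sum-bound-ℤ c VG EG k E F cA cB A≤B = begin
      L
    ≡⟨ sym (ℤP.+-identityʳ L) ⟩
      L ℤ.+ ℤ.0ℤ
    ≤⟨ ℤP.+-monoʳ-≤ L (ℤP.i≤j⇒0≤j-i A≤B) ⟩
      L ℤ.+ ((ℤ.+ 3 ℤ.* E ℤ.+ cA ℤ.+ cB ℤ.+ k) - (ℤ.+ 6 ℤ.* c ℤ.+ EG ℤ.+ ℤ.+ 2 ℤ.* VG ℤ.+ F))
    ≡⟨ identity c VG EG k E F cA cB ⟩
      ((ℤ.+ 2 ℤ.* E - (VG ℤ.+ E ℤ.+ ℤ.+ 2 ℤ.* c)) ℤ.+ cA) ℤ.+ ((ℤ.+ 2 ℤ.* E - (VG ℤ.+ E ℤ.+ ℤ.+ 2 ℤ.* c)) ℤ.+ cB)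
    ∎
    where
    open ℤP.≤-Reasoning
    L : ℤ
    L = ((c - (VG - EG)) - k) ℤ.+ (((c ℤ.+ VG) - E) ℤ.+ F)
    identity : ∀ (c VG EG k E F cA cB : ℤ) →
      (((c - (VG - EG)) - k) ℤ.+ (((c ℤ.+ VG) - E) ℤ.+ F)) ℤ.+
        ((ℤ.+ 3 ℤ.* E ℤ.+ cA ℤ.+ cB ℤ.+ k) - (ℤ.+ 6 ℤ.* c ℤ.+ EG ℤ.+ ℤ.+ 2 ℤ.* VG ℤ.+ F)) ≡
      ((ℤ.+ 2 ℤ.* E - (VG ℤ.+ E ℤ.+ ℤ.+ 2 ℤ.* c)) ℤ.+ cA) ℤ.+ ((ℤ.+ 2 ℤ.* E - (VG ℤ.+ E ℤ.+ ℤ.+ 2 ℤ.* c)) ℤ.+ cB)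
    identity = ℤSolver.solve-∀

  β₁-sum-bound : ∀ {n} (D : Diagram n) (k : ℕ) → let open Diagram D in
    6 * c + #EG + 2 * #VG + #F ≤ 3 * #E + compA + compB + k →
    ((ℤ.+ c - χG) - ℤ.+ k) ℤ.+ χΣ ℤ.≤ β₁SA ℤ.+ β₁SB
  β₁-sum-bound D k A≤B = subst₂ ℤ._≤_ (sym lhs) (sym rhs)
    (β₁-sum-bound-ℤ (ℤ.+ c) (ℤ.+ #VG) (ℤ.+ #EG) (ℤ.+ k) (ℤ.+ #E) (ℤ.+ #F) (ℤ.+ compA) (ℤ.+ compB)
      (subst₂ ℤ._≤_ castA castB (ℤ.+≤+ A≤B)))
    where
    open Diagram D
    lhs : ((ℤ.+ c - χG) - ℤ.+ k) ℤ.+ χΣ ≡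
          ((ℤ.+ c - (ℤ.+ #VG - ℤ.+ #EG)) - ℤ.+ k) ℤ.+ (((ℤ.+ c ℤ.+ ℤ.+ #VG) - ℤ.+ #E) ℤ.+ ℤ.+ #F)
    lhs = cong (λ v → ((ℤ.+ c - χG) - ℤ.+ k) ℤ.+ ((v - ℤ.+ #E) ℤ.+ ℤ.+ #F))
               (trans (cong ℤ.+_ (DiagramFacts.#V≡c+#VG D)) (ℤP.pos-+ c #VG))
    rhs : β₁SA ℤ.+ β₁SB ≡ ((ℤ.+ 2 ℤ.* ℤ.+ #E - (ℤ.+ #VG ℤ.+ ℤ.+ #E ℤ.+ ℤ.+ 2 ℤ.* ℤ.+ c)) ℤ.+ ℤ.+ compA) ℤ.+
                          ((ℤ.+ 2 ℤ.* ℤ.+ #E - (ℤ.+ #VG ℤ.+ ℤ.+ #E ℤ.+ ℤ.+ 2 ℤ.* ℤ.+ c)) ℤ.+ ℤ.+ compB)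
    rhs = cong (λ v → (v ℤ.+ ℤ.+ compA) ℤ.+ (v ℤ.+ ℤ.+ compB))
      (cong₂ _-_ (ℤP.pos-* 2 #E) (trans (ℤP.pos-+ (#VG + #E) (2 * c)) (cong₂ ℤ._+_ (ℤP.pos-+ #VG #E) (ℤP.pos-* 2 c))))
    castA : ℤ.+ (6 * c + #EG + 2 * #VG + #F) ≡ ℤ.+ 6 ℤ.* ℤ.+ c ℤ.+ ℤ.+ #EG ℤ.+ ℤ.+ 2 ℤ.* ℤ.+ #VG ℤ.+ ℤ.+ #F
    castA = trans (ℤP.pos-+ (6 * c + #EG + 2 * #VG) #F) (cong (ℤ._+ ℤ.+ #F) (trans (ℤP.pos-+ (6 * c + #EG) (2 * #VG))
              (cong₂ ℤ._+_ (trans (ℤP.pos-+ (6 * c) #EG) (cong (ℤ._+ ℤ.+ #EG) (ℤP.pos-* 6 c))) (ℤP.pos-* 2 #VG))))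
    castB : ℤ.+ (3 * #E + compA + compB + k) ≡ ℤ.+ 3 ℤ.* ℤ.+ #E ℤ.+ ℤ.+ compA ℤ.+ ℤ.+ compB ℤ.+ ℤ.+ k
    castB = trans (ℤP.pos-+ (3 * #E + compA + compB) k) (cong (ℤ._+ ℤ.+ k) (trans (ℤP.pos-+ (3 * #E + compA) compB)
              (cong (ℤ._+ ℤ.+ compB) (trans (ℤP.pos-+ (3 * #E) compA) (cong (ℤ._+ ℤ.+ compA) (ℤP.pos-* 3 #E))))))

  checkerboard-bound : ∀ {n m k} (D : Diagram n) (D' : Diagram (n + m)) → AddsEdges D D' k → CheckerboardDecorated D' →
    let open Diagram D in 6 * c + #EG + 2 * #VG + #F ≤ 3 * #E + compA + compB + k
  checkerboard-bound {k = k} D D' adds (col , col-θ₀ , col-θ₁ , col-θ₂ , isA≡col) =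
    sum-of-colour-bounds D.c D.#VG D.#EG D.#E D.#F k D.compA D.compB D'.c D'.#VG
      (numOrbits D'.fGens (not ∘ col)) (numOrbits D'.fGens (not ∘ not ∘ col))
      vertices faces (AddingEdges.c≤c' D D' adds) (DiagramFacts.#EG+2c≤#E D)
      (colour-bound D D' adds col col-θ₀ col-θ₁ col-θ₂ D.isA D'.isA isA-old D.A-corner isA≡col)
      (colour-bound D D' adds (not ∘ col) (cong not ∘ col-θ₀) (cong not ∘ col-θ₁) (cong not ∘ col-θ₂)
         (not ∘ D.isA) (not ∘ D'.isA) (cong not ∘ isA-old) (λ f → cong not ∘ D.A-corner f) (λ f → cong not ∘ isA≡col f))
    where
    module D  = Diagram D
    module D' = Diagram D'
    open AddsEdges adds using (isA-old)
    vertices : D'.c + D'.#VG ≡ D.c + D.#VG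
    vertices = trans (sym (DiagramFacts.#V≡c+#VG D')) (trans (AddsEdges.vertices adds) (DiagramFacts.#V≡c+#VG D))
    faces : D.#F + k ≡ numOrbits D'.fGens (not ∘ col) + numOrbits D'.fGens (not ∘ not ∘ col)
    faces = trans (sym (AddsEdges.faces adds)) (trans (countFin-split _ (not ∘ col))
              (cong₂ _+_ (countFin-cong _ _ (λ i → cong (_∧ not (col i)) (∧-identityʳ _)))
                         (countFin-cong _ _ (λ i → cong (_∧ not (not (col i))) (∧-identityʳ _)))))

open SmoothingBounds using (β₁-sum-bound; checkerboard-bound)

open import Data.Nat using (ℕ; _+_; _/_)
open import Data.Integer using (ℤ; +_; _-_; _≤_)
open import Data.Product using (Σ; _×_; _,_)

theorem5p12 : ∀ {n} (D : Diagram n) → GMap.Connected (Diagram.map D)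
  → (Σ ℕ λ m → Σ (Diagram (n + m)) λ D' →
       AddsEdges D D' (Diagram.oG D / 2) × Diagram.Eulerian D' × CheckerboardDecorated D')
  → ((+ Diagram.c D - Diagram.χG D) - + (Diagram.oG D / 2)) Data.Integer.+ GMap.χΣ (Diagram.map D)
      ≤ Diagram.β₁SA D Data.Integer.+ Diagram.β₁SB D
theorem5p12 D _ (m , D' , adds , _ , colouring) =
  β₁-sum-bound D (Diagram.oG D / 2) (checkerboard-bound D D' adds colouring)
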